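{- For every $\delta>0$ there exists $c>0$ such that the following holds for $G=G(n,p)$ with $p=p(n)$: if $p\le c\,n^{ -1/2}$, then with high probability (i.e. with probability tending to $1$ as $n\to\infty$) $\mathrm{Gallai}(G)\ge 3^{(1-\delta)e(G)}$.
   Context: $G(n,p)$ denotes the Erdős–Rényi random graph on $n$ vertices in which each pair of vertices is an edge independently with probability $p$. For a graph $G$, $e(G)=|E(G)|$. A Gallai $3$-colouring of a graph $G$ is a colouring of $E(G)$ with colours $\{1,2,3\}$ containing no rainbow triangle, i.e. no triangle whose three edges receive three distinct colours. $\mathrm{Gallai}(G)$ denotes the number of Gallai $3$-colourings of $G$.
   Formalization: The parameter δ ranges over the positive rationals, and the edge probability p = p(n) of G(n,p) takes rational values in [0,1] for every n. -}

module Defs where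
open import Data.Bool using (Bool; true; false; _∧_; _∨_; not; if_then_else_)
open import Data.Nat as ℕ using (ℕ; zero; suc; _≤ᵇ_; _≡ᵇ_; _<ᵇ_)
open import Data.Fin using (Fin; toℕ)
open import Data.Integer as ℤ using (ℤ; +_; -[1+_])
open import Data.List using (List; []; _∷_; map; concatMap; upTo; length; filter; foldr; zip; [_])
open import Data.Maybe using (Maybe; just; nothing)
open import Data.Product using (_×_; _,_; proj₁; proj₂)
open import Data.Rational as ℚ using (ℚ; 0ℚ; 1ℚ; _/_; ↥_; ↧ₙ_)



-- Vertices of G(n,p) are 0,…,n-1.  The possible edges are the pairs (i , j) with i < j < n,
-- listed in a fixed order.
pairsOf : ℕ → List (ℕ × ℕ)
pairsOf n = concatMap (λ j → map (λ i → (i , j)) (upTo j)) (upTo n)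

numPairs : ℕ → ℕ
numPairs n = length (pairsOf n)

allBools : ℕ → List (List Bool)
allBools zero = [] ∷ []
allBools (suc k) = concatMap (λ s → (true ∷ s) ∷ (false ∷ s) ∷ []) (allBools k)

-- A graph on vertex set {0,…,n-1} is given by a selector: a Bool-list of length numPairs n
-- saying which pairs are edges.  The edge list of a selector:
selectEdges : List (ℕ × ℕ) → List Bool → List (ℕ × ℕ)
selectEdges [] _ = []
selectEdges (_ ∷ _) [] = []
selectEdges (e ∷ es) (true ∷ bs) = e ∷ selectEdges es bs
selectEdges (e ∷ es) (false ∷ bs) = selectEdges es bs

Graphs : ℕ → List (List Bool)
Graphs n = allBools (numPairs n)

edges : ℕ → List Bool → List (ℕ × ℕ)
edges n g = selectEdges (pairsOf n) g

eG : ℕ → List Bool → ℕ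
eG n g = length (edges n g)

-- all lists over Fin 3 of length k; a colouring of a graph with edge list E is such a list of
-- length |E| (the i-th entry is the colour of the i-th edge).  Colour set {1,2,3} ≅ Fin 3.
allCols : ℕ → List (List (Fin 3))
allCols zero = [] ∷ []
allCols (suc k) = concatMap (λ s → map (λ c → c ∷ s) (Data.List.allFin 3)) (allCols k)

colourOf : List ((ℕ × ℕ) × Fin 3) → ℕ → ℕ → Maybe (Fin 3)
colourOf [] i j = nothing
colourOf (((a , b) , c) ∷ rest) i j =
  if (a ≡ᵇ i) ∧ (b ≡ᵇ j) then just c else colourOf rest i j

distinct : Fin 3 → Fin 3 → Bool
distinct x y = not (toℕ x ≡ᵇ toℕ y)

triplesOf : ℕ → List (ℕ × ℕ × ℕ)
triplesOf n = concatMap (λ k → concatMap (λ j → map (λ i → (i , j , k)) (upTo j)) (upTo k)) (upTo n)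

rainbow : List ((ℕ × ℕ) × Fin 3) → ℕ × ℕ × ℕ → Bool
rainbow col (i , j , k) with colourOf col i j | colourOf col i k | colourOf col j k
... | just x | just y | just z = distinct x y ∧ distinct x z ∧ distinct y z
... | _ | _ | _ = false

andL : List Bool → Bool
andL = foldr _∧_ true

isGallai : ℕ → List (ℕ × ℕ) → List (Fin 3) → Bool
isGallai n es cs = andL (map (λ t → not (rainbow (zip es cs) t)) (triplesOf n))

countTrue : List Bool → ℕ
countTrue [] = 0
countTrue (true ∷ bs) = suc (countTrue bs)
countTrue (false ∷ bs) = countTrue bs

gallai : ℕ → List Bool → ℕ
gallai n g = countTrue (map (isGallai n (edges n g)) (allCols (eG n g)))

-- x ≥ 3^(u/v)  for x : ℕ, u : ℤ, v ≥ 1 (decided exactly, without reals)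
geq3pow : ℕ → ℤ → ℕ → Bool
geq3pow x (+ u) v = (3 ℕ.^ u) ≤ᵇ (x ℕ.^ v)
geq3pow x -[1+ k ] v = 1 ≤ᵇ (x ℕ.^ v ℕ.* 3 ℕ.^ suc k)

-- The event  Gallai(G) ≥ 3^((1-δ) e(G))  for rational δ = num/den:
-- (1-δ) e = ((den - num) * e) / den.
goodEvent : ℚ → ℕ → List Bool → Bool
goodEvent δ n g =
  geq3pow (gallai n g) ((+ (↧ₙ δ) ℤ.- (↥ δ)) ℤ.* (+ eG n g)) (↧ₙ δ)

_^ℚ_ : ℚ → ℕ → ℚ
x ^ℚ zero = 1ℚ
x ^ℚ suc k = x ℚ.* (x ^ℚ k)

-- probability that G(n,p) has NOT the property (a finite sum over all graphs on n vertices)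
probBad : ℚ → ℕ → ℚ → ℚ
probBad δ n p =
  foldr ℚ._+_ 0ℚ
    (map (λ g → if goodEvent δ n g then 0ℚ
                else (p ^ℚ eG n g) ℚ.* ((1ℚ ℚ.- p) ^ℚ (numPairs n ℕ.∸ eG n g)))
         (Graphs n))

ℕtoℚ : ℕ → ℚ
ℕtoℚ n = (+ n) / 1

module Submission where

open import Defs
open import Data.Nat using (ℕ; _≥_)
open import Data.Rational using (ℚ; 0ℚ; 1ℚ; _≤_; _<_; _*_; _-_)
open import Data.Product using (Σ; _×_; ∃-syntax)

open import Data.Bool using (Bool; true; false; _∧_; _∨_; not; if_then_else_; T)
import Data.Bool.Properties as Boolₚ
open import Data.Bool.ListAction using (any)
open import Data.Empty using (⊥-elim)
open import Data.Fin using (Fin; toℕ)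
open import Data.Integer as ℤ using (-[1+_])
import Data.Integer.Properties as ℤₚ
import Data.Integer.Tactic.RingSolver as ℤSolver
open import Data.List using (List; []; _∷_; _++_; [_]; map; concatMap; foldr; length; upTo; zip)
import Data.List.Properties as Listₚ
open import Data.List.Membership.Propositional using (_∈_; find; lose)
open import Data.List.Membership.Propositional.Properties
  using (∈-concatMap⁺; ∈-concatMap⁻; ∈-map⁺; ∈-map⁻; ∈-upTo⁺; ∈-upTo⁻)
open import Data.List.Relation.Binary.Disjoint.Propositional using (Disjoint)
open import Data.List.Relation.Unary.All as All using (All; []; _∷_)
import Data.List.Relation.Unary.All.Properties as Allₚ
open import Data.List.Relation.Unary.AllPairs as AllPairs using ([]; _∷_)
import Data.List.Relation.Unary.AllPairs.Properties as AllPairsₚ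
open import Data.List.Relation.Unary.Any as Any using (here; there)
open import Data.List.Relation.Unary.Unique.Propositional using (Unique)
import Data.List.Relation.Unary.Unique.Propositional.Properties as Uniqueₚ
open import Data.Maybe using (just; nothing)
import Data.Maybe.Properties as Maybeₚ
open import Data.Nat as ℕ using (zero; suc; _≡ᵇ_; _<ᵇ_; _∸_; _^_; z≤n; s≤s)
import Data.Nat.Coprimality as Coprime
import Data.Nat.Properties as ℕₚ
import Data.Nat.Tactic.RingSolver as ℕSolver
open import Data.Product using (_,_; proj₁; proj₂)
open import Data.Rational as ℚ
  using (_+_; -_; mkℚ; toℚᵘ; ↥_; ↧ₙ_; 1/_; Positive; nonNegative; nonPositive; positive)
open import Data.Rational.Properties
open import Data.Rational.Solver using (module +-*-Solver)
import Data.Rational.Unnormalised as ℚᵘ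
import Data.Rational.Unnormalised.Properties as ℚᵘₚ
open import Data.Sum using (_⊎_; inj₁; inj₂; [_,_]′)
open import Data.Unit using (tt)
open import Function using (_∘_)
open import Relation.Binary.PropositionalEquality
  using (_≡_; _≢_; refl; sym; trans; cong; cong₂; subst; subst₂; module ≡-Reasoning)
open import Relation.Nullary using (yes; no; contradiction)

open +-*-Solver using (solve; _:+_; _:*_; _:-_; :-_; con; _:=_)

-- Colour every edge lying in a triangle with colour 0 and every other edge arbitrarily: no
-- triangle is rainbow, so Gallai(G) ≥ 3^(e − m), where m ≤ 3T counts the edges lying in
-- triangles and T the triangles. With δ = a/d the bad event therefore forces a·e < 3d·T.
-- If (np)³ is small, the first moment 𝔼T ≤ (np)³ bounds its probability. Otherwise
-- μ = (n choose 2)·p is large; as 48 d n p² ≤ 1 we have 12d·𝔼T ≤ a·μ, so on the bad event either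
-- e ≤ μ/2 or T − 𝔼T ≥ aμ/(12d). Chebyshev's inequality with Var e ≤ μ and Var T ≤ 9 n⁴ p³
-- gives μ² P ≤ 4μ + C n⁴ p³, that is P = O(1/μ + p), and p ≤ c n^(-1/2) tends to 0.
-- Probabilities are exact finite sums over all graphs, so the argument is rational arithmetic.

private variable
  A B : Set
  a b c d q r x y : ℚ

+-nonNeg : 0ℚ ≤ a → 0ℚ ≤ b → 0ℚ ≤ a + b
+-nonNeg 0≤a 0≤b = +-mono-≤ 0≤a 0≤b

*-nonNeg : 0ℚ ≤ a → 0ℚ ≤ b → 0ℚ ≤ a * b
*-nonNeg {a} {b} 0≤a 0≤b = nonNegative⁻¹ (a * b)
  {{nonNeg*nonNeg⇒nonNeg a {{nonNegative 0≤a}} b {{nonNegative 0≤b}}}}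

*-pos : 0ℚ < a → 0ℚ < b → 0ℚ < a * b
*-pos {a} {b} 0<a 0<b = positive⁻¹ (a * b) {{pos*pos⇒pos a {{positive 0<a}} b {{positive 0<b}}}}

*-monoˡ-≤-nonNeg′ : 0ℚ ≤ r → a ≤ b → r * a ≤ r * b
*-monoˡ-≤-nonNeg′ {r} 0≤r = *-monoˡ-≤-nonNeg r {{nonNegative 0≤r}}

*-monoʳ-≤-nonNeg′ : 0ℚ ≤ r → a ≤ b → a * r ≤ b * r
*-monoʳ-≤-nonNeg′ {r} 0≤r = *-monoʳ-≤-nonNeg r {{nonNegative 0≤r}}

*-mono-≤-nonNeg′ : 0ℚ ≤ a → 0ℚ ≤ c → a ≤ b → c ≤ d → a * c ≤ b * d
*-mono-≤-nonNeg′ 0≤a 0≤c a≤b c≤d =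
  ≤-trans (*-monoˡ-≤-nonNeg′ 0≤a c≤d) (*-monoʳ-≤-nonNeg′ (≤-trans 0≤c c≤d) a≤b)

*-cancelˡ-≤-pos′ : 0ℚ < r → r * a ≤ r * b → a ≤ b
*-cancelˡ-≤-pos′ {r} 0<r = *-cancelˡ-≤-pos r {{positive 0<r}}

*-left-comm : ∀ a b c → a * (b * c) ≡ b * (a * c)
*-left-comm = solve 3 (λ a b c → a :* (b :* c) := b :* (a :* c)) refl

0≤1 : 0ℚ ≤ 1ℚ
0≤1 = <⇒≤ (positive⁻¹ 1ℚ)

0≤y-x⇒x≤y : 0ℚ ≤ y - x → x ≤ y
0≤y-x⇒x≤y {y} {x} 0≤y-x = begin
  x             ≡⟨ sym (+-identityʳ x) ⟩
  x + 0ℚ        ≤⟨ +-monoʳ-≤ x 0≤y-x ⟩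
  x + (y - x)   ≡⟨ cancel x y ⟩
  y             ∎
  where
  open ≤-Reasoning
  cancel : ∀ x y → x + (y - x) ≡ y
  cancel = solve 2 (λ x y → x :+ (y :- x) := y) refl

x≤y⇒0≤y-x : x ≤ y → 0ℚ ≤ y - x
x≤y⇒0≤y-x {x} {y} x≤y = ≤-trans (≤-reflexive (sym (+-inverseʳ x))) (+-monoˡ-≤ (- x) x≤y)

x≤x+y : 0ℚ ≤ y → x ≤ x + y
x≤x+y {y} {x} 0≤y = ≤-trans (≤-reflexive (sym (+-identityʳ x))) (+-monoʳ-≤ x 0≤y)

y≤x+y : 0ℚ ≤ x → y ≤ x + y
y≤x+y {x} {y} 0≤x = ≤-trans (≤-reflexive (sym (+-identityˡ y))) (+-monoˡ-≤ y 0≤x)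

x-y≤x : 0ℚ ≤ y → x - y ≤ x
x-y≤x {y} {x} 0≤y = 0≤y-x⇒x≤y (≤-trans 0≤y (≤-reflexive (sym (cancel x y))))
  where
  cancel : ∀ x y → x - (x - y) ≡ y
  cancel = solve 2 (λ x y → x :- (x :- y) := y) refl

_² : ℚ → ℚ
x ² = x * x

_³ : ℚ → ℚ
x ³ = x * x ²

infix 8 _² _³

²-nonNeg : ∀ x → 0ℚ ≤ x ²
²-nonNeg x with ≤-total 0ℚ x
... | inj₁ 0≤x = *-nonNeg 0≤x 0≤x
... | inj₂ x≤0 = ≤-trans (≤-reflexive (sym (*-zeroʳ x))) (*-monoˡ-≤-nonPos x {{nonPositive x≤0}} x≤0)

³-nonNeg : 0ℚ ≤ x → 0ℚ ≤ x ³
³-nonNeg {x} 0≤x = *-nonNeg 0≤x (²-nonNeg x)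

²-mono-≤ : 0ℚ ≤ x → x ≤ y → x ² ≤ y ²
²-mono-≤ 0≤x x≤y = *-mono-≤-nonNeg′ 0≤x 0≤x x≤y x≤y

³-mono-≤ : 0ℚ ≤ x → x ≤ y → x ³ ≤ y ³
³-mono-≤ {x} 0≤x x≤y = *-mono-≤-nonNeg′ 0≤x (²-nonNeg x) x≤y (²-mono-≤ 0≤x x≤y)

²-mono-< : 0ℚ ≤ x → x < y → x ² < y ²
²-mono-< {x} {y} 0≤x x<y =
  ≤-<-trans (*-monoˡ-≤-nonNeg′ 0≤x (<⇒≤ x<y)) (*-monoˡ-<-pos y {{positive (≤-<-trans 0≤x x<y)}} x<y)

³-mono-< : 0ℚ ≤ x → x < y → x ³ < y ³
³-mono-< {x} {y} 0≤x x<y = ≤-<-trans (*-monoˡ-≤-nonNeg′ 0≤x (²-mono-≤ 0≤x (<⇒≤ x<y)))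
  (*-monoˡ-<-pos (y ²) {{positive (*-pos 0<y 0<y)}} x<y)
  where 0<y = ≤-<-trans 0≤x x<y

strictMono⇒cancel-≤ : (f : ℚ → ℚ) → (∀ {u v} → 0ℚ ≤ u → u < v → f u < f v) → 0ℚ ≤ y → f x ≤ f y → x ≤ y
strictMono⇒cancel-≤ {y} {x} f mono 0≤y fx≤fy with x ≤? y
... | yes x≤y = x≤y
... | no  x≰y = ⊥-elim (<-irrefl refl (<-≤-trans (mono 0≤y (≰⇒> x≰y)) fx≤fy))

²-cancel-≤ : 0ℚ ≤ y → x ² ≤ y ² → x ≤ y
²-cancel-≤ = strictMono⇒cancel-≤ _² ²-mono-<

³-cancel-≤ : 0ℚ ≤ y → x ³ ≤ y ³ → x ≤ y
³-cancel-≤ = strictMono⇒cancel-≤ _³ ³-mono-<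

^ℚ-nonNeg : 0ℚ ≤ q → ∀ m → 0ℚ ≤ q ^ℚ m
^ℚ-nonNeg 0≤q zero    = 0≤1
^ℚ-nonNeg 0≤q (suc m) = *-nonNeg 0≤q (^ℚ-nonNeg 0≤q m)

^ℚ-≤1 : 0ℚ ≤ q → q ≤ 1ℚ → ∀ m → q ^ℚ m ≤ 1ℚ
^ℚ-≤1 0≤q q≤1 zero    = ≤-refl
^ℚ-≤1 0≤q q≤1 (suc m) =
  ≤-trans (*-mono-≤-nonNeg′ 0≤q (^ℚ-nonNeg 0≤q m) q≤1 (^ℚ-≤1 0≤q q≤1 m)) (≤-reflexive (*-identityˡ 1ℚ))

^ℚ-+ : ∀ q m o → q ^ℚ (m ℕ.+ o) ≡ q ^ℚ m * q ^ℚ o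
^ℚ-+ q zero    o = sym (*-identityˡ _)
^ℚ-+ q (suc m) o = trans (cong (q *_) (^ℚ-+ q m o)) (sym (*-assoc q _ _))

^ℚ-antitone : 0ℚ ≤ q → q ≤ 1ℚ → ∀ {m o} → m ℕ.≤ o → q ^ℚ o ≤ q ^ℚ m
^ℚ-antitone {q} 0≤q q≤1 {m} m≤o with ℕₚ.m≤n⇒∃[o]m+o≡n m≤o
... | d , refl = begin
  q ^ℚ (m ℕ.+ d)        ≡⟨ ^ℚ-+ q m d ⟩
  q ^ℚ m * q ^ℚ d       ≤⟨ *-monoˡ-≤-nonNeg′ (^ℚ-nonNeg 0≤q m) (^ℚ-≤1 0≤q q≤1 d) ⟩
  q ^ℚ m * 1ℚ           ≡⟨ *-identityʳ _ ⟩
  q ^ℚ m                ∎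
  where open ≤-Reasoning

ℕtoℚ≡mkℚ : ∀ n → ℕtoℚ n ≡ mkℚ (ℤ.+ n) 0 (Coprime.sym (Coprime.1-coprimeTo n))
ℕtoℚ≡mkℚ n = normalize-coprime (Coprime.sym (Coprime.1-coprimeTo n))

private
  toℚᵘ-ℕtoℚ : ∀ n → toℚᵘ (ℕtoℚ n) ≡ ℚᵘ.mkℚᵘ (ℤ.+ n) 0
  toℚᵘ-ℕtoℚ n = cong toℚᵘ (ℕtoℚ≡mkℚ n)

  +-over-1 : ∀ a b → (a ℤ.+ b) ℤ.* ℤ.+ 1 ≡ (a ℤ.* ℤ.+ 1 ℤ.+ b ℤ.* ℤ.+ 1) ℤ.* ℤ.+ 1
  +-over-1 = ℤSolver.solve-∀

ℕtoℚ-+ : ∀ m n → ℕtoℚ (m ℕ.+ n) ≡ ℕtoℚ m + ℕtoℚ n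
ℕtoℚ-+ m n = toℚᵘ-injective (begin
  toℚᵘ (ℕtoℚ (m ℕ.+ n))                 ≡⟨ toℚᵘ-ℕtoℚ (m ℕ.+ n) ⟩
  ℚᵘ.mkℚᵘ (ℤ.+ (m ℕ.+ n)) 0               ≈⟨ ℚᵘ.*≡* (trans (cong (ℤ._* ℤ.+ 1) (ℤₚ.pos-+ m n)) (+-over-1 (ℤ.+ m) (ℤ.+ n))) ⟩
  ℚᵘ.mkℚᵘ (ℤ.+ m) 0 ℚᵘ.+ ℚᵘ.mkℚᵘ (ℤ.+ n) 0  ≡⟨ sym (cong₂ ℚᵘ._+_ (toℚᵘ-ℕtoℚ m) (toℚᵘ-ℕtoℚ n)) ⟩
  toℚᵘ (ℕtoℚ m) ℚᵘ.+ toℚᵘ (ℕtoℚ n)      ≈⟨ ℚᵘₚ.≃-sym (toℚᵘ-homo-+ (ℕtoℚ m) (ℕtoℚ n)) ⟩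
  toℚᵘ (ℕtoℚ m + ℕtoℚ n)                ∎)
  where open ℚᵘₚ.≃-Reasoning

ℕtoℚ-* : ∀ m n → ℕtoℚ (m ℕ.* n) ≡ ℕtoℚ m * ℕtoℚ n
ℕtoℚ-* m n = toℚᵘ-injective (begin
  toℚᵘ (ℕtoℚ (m ℕ.* n))                 ≡⟨ toℚᵘ-ℕtoℚ (m ℕ.* n) ⟩
  ℚᵘ.mkℚᵘ (ℤ.+ (m ℕ.* n)) 0               ≈⟨ ℚᵘ.*≡* (cong (ℤ._* ℤ.+ 1) (ℤₚ.pos-* m n)) ⟩
  ℚᵘ.mkℚᵘ (ℤ.+ m) 0 ℚᵘ.* ℚᵘ.mkℚᵘ (ℤ.+ n) 0  ≡⟨ sym (cong₂ ℚᵘ._*_ (toℚᵘ-ℕtoℚ m) (toℚᵘ-ℕtoℚ n)) ⟩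
  toℚᵘ (ℕtoℚ m) ℚᵘ.* toℚᵘ (ℕtoℚ n)      ≈⟨ ℚᵘₚ.≃-sym (toℚᵘ-homo-* (ℕtoℚ m) (ℕtoℚ n)) ⟩
  toℚᵘ (ℕtoℚ m * ℕtoℚ n)                ∎)
  where open ℚᵘₚ.≃-Reasoning

ℕtoℚ-suc : ∀ n → ℕtoℚ (suc n) ≡ 1ℚ + ℕtoℚ n
ℕtoℚ-suc = ℕtoℚ-+ 1

ℕtoℚ-nonNeg : ∀ n → 0ℚ ≤ ℕtoℚ n
ℕtoℚ-nonNeg n = nonNegative⁻¹ (ℕtoℚ n) {{normalize-nonNeg n 1}}

ℕtoℚ-pos : ∀ n → 0ℚ < ℕtoℚ (suc n)
ℕtoℚ-pos n = positive⁻¹ (ℕtoℚ (suc n)) {{normalize-pos (suc n) 1}}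

ℕtoℚ-mono-≤ : ∀ {m n} → m ℕ.≤ n → ℕtoℚ m ≤ ℕtoℚ n
ℕtoℚ-mono-≤ {m} m≤n with ℕₚ.m≤n⇒∃[o]m+o≡n m≤n
... | o , refl = begin
  ℕtoℚ m              ≡⟨ sym (+-identityʳ (ℕtoℚ m)) ⟩
  ℕtoℚ m + 0ℚ         ≤⟨ +-monoʳ-≤ (ℕtoℚ m) (ℕtoℚ-nonNeg o) ⟩
  ℕtoℚ m + ℕtoℚ o     ≡⟨ sym (ℕtoℚ-+ m o) ⟩
  ℕtoℚ (m ℕ.+ o)      ∎
  where open ≤-Reasoning

archimedean : ∀ y → ∃[ N ] y ≤ ℕtoℚ N
archimedean y@(mkℚ (ℤ.+ k) d _) = k , subst (y ≤_) (sym (ℕtoℚ≡mkℚ k)) (ℚ.*≤*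
  (subst₂ ℤ._≤_ (sym (ℤₚ.*-identityʳ (ℤ.+ k))) (ℤₚ.pos-* k (suc d)) (ℤ.+≤+ (ℕₚ.m≤m*n k (suc d)))))
archimedean y@(mkℚ -[1+ k ] d _) = 0 , <⇒≤ (negative⁻¹ y)

archimedean-* : ∀ {z} → 0ℚ < z → ∀ y → ∃[ N ] y ≤ ℕtoℚ N * z
archimedean-* {z} 0<z y = N , (begin
  y                ≡⟨ sym (trans (*-assoc y (1/ z) z) (trans (cong (y *_) (*-inverseˡ z)) (*-identityʳ y))) ⟩
  y * 1/ z * z     ≤⟨ *-monoʳ-≤-nonNeg′ (<⇒≤ 0<z) (proj₂ (archimedean (y * 1/ z))) ⟩
  ℕtoℚ N * z       ∎)
  where
  open ≤-Reasoning
  instance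
    z≢0 = pos⇒nonZero z {{positive 0<z}}
  N = proj₁ (archimedean (y * 1/ z))

∑ : List A → (A → ℚ) → ℚ
∑ xs f = foldr _+_ 0ℚ (map f xs)

∑-cong : ∀ (xs : List A) {f g} → (∀ x → f x ≡ g x) → ∑ xs f ≡ ∑ xs g
∑-cong []       f≗g = refl
∑-cong (x ∷ xs) f≗g = cong₂ _+_ (f≗g x) (∑-cong xs f≗g)

∑-mono-≤ : ∀ (xs : List A) {f g} → (∀ x → f x ≤ g x) → ∑ xs f ≤ ∑ xs g
∑-mono-≤ []       f≤g = ≤-refl
∑-mono-≤ (x ∷ xs) f≤g = +-mono-≤ (f≤g x) (∑-mono-≤ xs f≤g)

∑-cong-∈ : ∀ (xs : List A) {f g} → (∀ {x} → x ∈ xs → f x ≡ g x) → ∑ xs f ≡ ∑ xs g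
∑-cong-∈ []       f≗g = refl
∑-cong-∈ (x ∷ xs) f≗g = cong₂ _+_ (f≗g (here refl)) (∑-cong-∈ xs (f≗g ∘ there))

∑-mono-≤-∈ : ∀ (xs : List A) {f g} → (∀ {x} → x ∈ xs → f x ≤ g x) → ∑ xs f ≤ ∑ xs g
∑-mono-≤-∈ []       f≤g = ≤-refl
∑-mono-≤-∈ (x ∷ xs) f≤g = +-mono-≤ (f≤g (here refl)) (∑-mono-≤-∈ xs (f≤g ∘ there))

∑-zero : ∀ (xs : List A) → ∑ xs (λ _ → 0ℚ) ≡ 0ℚ
∑-zero []       = refl
∑-zero (x ∷ xs) = trans (+-identityˡ _) (∑-zero xs)

∑-nonNeg : ∀ (xs : List A) {f} → (∀ x → 0ℚ ≤ f x) → 0ℚ ≤ ∑ xs f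
∑-nonNeg xs 0≤f = ≤-trans (≤-reflexive (sym (∑-zero xs))) (∑-mono-≤ xs 0≤f)

∑-++ : ∀ (xs ys : List A) f → ∑ (xs ++ ys) f ≡ ∑ xs f + ∑ ys f
∑-++ []       ys f = sym (+-identityˡ _)
∑-++ (x ∷ xs) ys f = trans (cong (f x +_) (∑-++ xs ys f)) (sym (+-assoc (f x) _ _))

∑-map : ∀ (h : B → A) (xs : List B) f → ∑ (map h xs) f ≡ ∑ xs (λ x → f (h x))
∑-map h []       f = refl
∑-map h (x ∷ xs) f = cong (f (h x) +_) (∑-map h xs f)

∑-concatMap : ∀ (h : B → List A) (xs : List B) f → ∑ (concatMap h xs) f ≡ ∑ xs (λ x → ∑ (h x) f)
∑-concatMap h []       f = refl
∑-concatMap h (x ∷ xs) f = trans (∑-++ (h x) (concatMap h xs) f) (cong (∑ (h x) f +_) (∑-concatMap h xs f))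

∑-+ : ∀ (xs : List A) f g → ∑ xs (λ x → f x + g x) ≡ ∑ xs f + ∑ xs g
∑-+ []       f g = refl
∑-+ (x ∷ xs) f g = trans (cong (f x + g x +_) (∑-+ xs f g)) (interchange (f x) (g x) (∑ xs f) (∑ xs g))
  where
  interchange : ∀ a b c d → a + b + (c + d) ≡ a + c + (b + d)
  interchange = solve 4 (λ a b c d → a :+ b :+ (c :+ d) := a :+ c :+ (b :+ d)) refl

∑-*ˡ : ∀ (xs : List A) c f → ∑ xs (λ x → c * f x) ≡ c * ∑ xs f
∑-*ˡ []       c f = sym (*-zeroʳ c)
∑-*ˡ (x ∷ xs) c f = trans (cong (c * f x +_) (∑-*ˡ xs c f)) (sym (*-distribˡ-+ c (f x) _))

∑-*ʳ : ∀ (xs : List A) c f → ∑ xs (λ x → f x * c) ≡ ∑ xs f * c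
∑-*ʳ xs c f = trans (∑-cong xs (λ x → *-comm (f x) c)) (trans (∑-*ˡ xs c f) (*-comm c _))

∑-sub : ∀ (xs : List A) f g → ∑ xs (λ x → f x - g x) ≡ ∑ xs f - ∑ xs g
∑-sub []       f g = refl
∑-sub (x ∷ xs) f g = trans (cong (f x - g x +_) (∑-sub xs f g)) (interchange (f x) (g x) (∑ xs f) (∑ xs g))
  where
  interchange : ∀ a b c d → a - b + (c - d) ≡ a + c - (b + d)
  interchange = solve 4 (λ a b c d → a :- b :+ (c :- d) := a :+ c :- (b :+ d)) refl

∑-const : ∀ (xs : List A) c → ∑ xs (λ _ → c) ≡ ℕtoℚ (length xs) * c
∑-const []       c = sym (*-zeroˡ c)
∑-const (x ∷ xs) c = begin
  c + ∑ xs (λ _ → c)              ≡⟨ cong (c +_) (∑-const xs c) ⟩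
  c + ℕtoℚ (length xs) * c        ≡⟨ factor c (ℕtoℚ (length xs)) ⟩
  (1ℚ + ℕtoℚ (length xs)) * c     ≡⟨ cong (_* c) (sym (ℕtoℚ-suc (length xs))) ⟩
  ℕtoℚ (suc (length xs)) * c      ∎
  where
  open ≡-Reasoning
  factor : ∀ c l → c + l * c ≡ (1ℚ + l) * c
  factor = solve 2 (λ c l → c :+ l :* c := (con 1ℚ :+ l) :* c) refl

∑-comm : ∀ (xs : List A) (ys : List B) (f : A → B → ℚ) → ∑ xs (λ x → ∑ ys (f x)) ≡ ∑ ys (λ y → ∑ xs (λ x → f x y))
∑-comm []       ys f = sym (∑-zero ys)
∑-comm (x ∷ xs) ys f = trans (cong (∑ ys (f x) +_) (∑-comm xs ys f)) (sym (∑-+ ys (f x) _))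

∑-² : ∀ (xs : List A) f → (∑ xs f) ² ≡ ∑ xs (λ x → ∑ xs (λ y → f x * f y))
∑-² xs f = trans (sym (∑-*ʳ xs (∑ xs f) f)) (∑-cong xs (λ x → sym (∑-*ˡ xs (f x) f)))

∑-upTo-const : ∀ n c → ∑ (upTo n) (λ _ → c) ≡ ℕtoℚ n * c
∑-upTo-const n c = trans (∑-const (upTo n) c) (cong (λ m → ℕtoℚ m * c) (Listₚ.length-upTo n))

∑-upTo-≤ : ∀ n {f : ℕ → ℚ} → (∀ i → f i ≤ c) → ∑ (upTo n) f ≤ ℕtoℚ n * c
∑-upTo-≤ {c} n f≤c = ≤-trans (∑-mono-≤ (upTo n) f≤c) (≤-reflexive (∑-upTo-const n c))

𝟙 : Bool → ℚ
𝟙 true  = 1ℚ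
𝟙 false = 0ℚ

𝟙-nonNeg : ∀ b → 0ℚ ≤ 𝟙 b
𝟙-nonNeg true  = 0≤1
𝟙-nonNeg false = ≤-refl

𝟙-∧ : ∀ a b → 𝟙 (a ∧ b) ≡ 𝟙 a * 𝟙 b
𝟙-∧ true  b = sym (*-identityˡ (𝟙 b))
𝟙-∧ false b = sym (*-zeroˡ (𝟙 b))

𝟙-∨-≤ : ∀ a b → 𝟙 (a ∨ b) ≤ 𝟙 a + 𝟙 b
𝟙-∨-≤ true  b = ≤-trans (≤-reflexive (sym (+-identityʳ 1ℚ))) (+-monoʳ-≤ 1ℚ (𝟙-nonNeg b))
𝟙-∨-≤ false b = ≤-reflexive (sym (+-identityˡ (𝟙 b)))

𝟙-∨₃-≤ : ∀ a b c → 𝟙 (a ∨ (b ∨ c)) ≤ 𝟙 a + (𝟙 b + 𝟙 c)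
𝟙-∨₃-≤ a b c = ≤-trans (𝟙-∨-≤ a (b ∨ c)) (+-monoʳ-≤ (𝟙 a) (𝟙-∨-≤ b c))

∑-+₃ : ∀ (xs : List A) f g h → ∑ xs (λ x → f x + (g x + h x)) ≡ ∑ xs f + (∑ xs g + ∑ xs h)
∑-+₃ xs f g h = trans (∑-+ xs f _) (cong (∑ xs f +_) (∑-+ xs g h))

T⇒≡true : ∀ {b} → T b → b ≡ true
T⇒≡true {true} _ = refl

≡true⇒T : ∀ {b} → b ≡ true → T b
≡true⇒T refl = tt

≡ᵇ-true⇒≡ : ∀ m n → (m ≡ᵇ n) ≡ true → m ≡ n
≡ᵇ-true⇒≡ m n = ℕₚ.≡ᵇ⇒≡ m n ∘ ≡true⇒T

≡ᵇ-refl : ∀ m → (m ≡ᵇ m) ≡ true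
≡ᵇ-refl m = T⇒≡true (ℕₚ.≡⇒≡ᵇ m m refl)

<ᵇ-true⇒< : ∀ m n → (m <ᵇ n) ≡ true → m ℕ.< n
<ᵇ-true⇒< m n = ℕₚ.<ᵇ⇒< m n ∘ ≡true⇒T

<⇒<ᵇ-true : ∀ {m n} → m ℕ.< n → (m <ᵇ n) ≡ true
<⇒<ᵇ-true = T⇒≡true ∘ ℕₚ.<⇒<ᵇ

∨≡true⇒ : ∀ {a b} → a ∨ b ≡ true → a ≡ true ⊎ b ≡ true
∨≡true⇒ {true}  _     = inj₁ refl
∨≡true⇒ {false} b≡true = inj₂ b≡true

∧-interchange : ∀ a b c d → (a ∧ c) ∧ (b ∧ d) ≡ (a ∧ b) ∧ (c ∧ d)
∧-interchange true  true  c d = refl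
∧-interchange true  false c d = Boolₚ.∧-zeroʳ c
∧-interchange false b     c d = refl

count : (A → Bool) → List A → ℕ
count P xs = countTrue (map P xs)

count-∨ : ∀ (P Q : A → Bool) xs → (∀ x → P x ∧ Q x ≡ false) →
          count (λ x → P x ∨ Q x) xs ≡ count P xs ℕ.+ count Q xs
count-∨ P Q []       disjoint = refl
count-∨ P Q (x ∷ xs) disjoint with P x | Q x | disjoint x
... | true  | false | _ = cong suc (count-∨ P Q xs disjoint)
... | false | true  | _ = trans (cong suc (count-∨ P Q xs disjoint)) (sym (ℕₚ.+-suc _ _))
... | false | false | _ = count-∨ P Q xs disjoint

count-mono : ∀ (P Q : A → Bool) xs → (∀ x → P x ≡ true → Q x ≡ true) → count P xs ℕ.≤ count Q xs
count-mono P Q []       P⇒Q = z≤n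
count-mono P Q (x ∷ xs) P⇒Q with P x | Q x | P⇒Q x
... | true  | true  | _   = s≤s (count-mono P Q xs P⇒Q)
... | true  | false | P⇒Q′ with () ← P⇒Q′ refl
... | false | true  | _   = ℕₚ.m≤n⇒m≤1+n (count-mono P Q xs P⇒Q)
... | false | false | _   = count-mono P Q xs P⇒Q

count-not : ∀ (P : A → Bool) xs → count P xs ℕ.+ count (not ∘ P) xs ≡ length xs
count-not P []       = refl
count-not P (x ∷ xs) with P x
... | true  = cong suc (count-not P xs)
... | false = trans (ℕₚ.+-suc _ _) (cong suc (count-not P xs))

ℕtoℚ-count : ∀ (P : A → Bool) xs → ℕtoℚ (count P xs) ≡ ∑ xs (𝟙 ∘ P)
ℕtoℚ-count P []       = refl
ℕtoℚ-count P (x ∷ xs) with P x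
... | true  = trans (ℕtoℚ-suc (count P xs)) (cong (1ℚ +_) (ℕtoℚ-count P xs))
... | false = trans (ℕtoℚ-count P xs) (sym (+-identityˡ _))

All-false⇒count≡0 : ∀ {P : A → Bool} {xs} → All (λ x → P x ≡ false) xs → count P xs ≡ 0
All-false⇒count≡0 {P = P} {x ∷ xs} (Px≡false ∷ rest) rewrite Px≡false = All-false⇒count≡0 rest
All-false⇒count≡0 []                                  = refl

count-unique≤1 : ∀ {P : A → Bool} {a xs} → Unique xs → (∀ x → P x ≡ true → x ≡ a) → count P xs ℕ.≤ 1
count-unique≤1 {xs = []}     []                  onlyA = z≤n
count-unique≤1 {P = P} {xs = x ∷ xs} (x≢xs ∷ unique) onlyA with P x in Px
... | true  = s≤s (ℕₚ.≤-reflexive (All-false⇒count≡0 (All.map (λ {y} x≢y → Boolₚ.¬-not (λ Py →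
                x≢y (trans (onlyA x Px) (sym (onlyA y Py))))) x≢xs)))
... | false = count-unique≤1 unique onlyA

count-∈ : ∀ (P : A → Bool) {x xs} → x ∈ xs → P x ≡ true → 1 ℕ.≤ count P xs
count-∈ P {xs = y ∷ ys} (here refl) Px rewrite Px = s≤s z≤n
count-∈ P {xs = y ∷ ys} (there x∈ys) Px with P y
... | true  = s≤s z≤n
... | false = count-∈ P x∈ys Px

count-++ : ∀ (P : A → Bool) xs ys → count P (xs ++ ys) ≡ count P xs ℕ.+ count P ys
count-++ P []       ys = refl
count-++ P (x ∷ xs) ys with P x
... | true  = cong suc (count-++ P xs ys)
... | false = count-++ P xs ys

count-concatMap : ∀ (P : B → Bool) (Q : A → Bool) (f : A → List B) m →
                  (∀ x → count P (f x) ≡ m ℕ.* count Q [ x ]) → ∀ xs → count P (concatMap f xs) ≡ m ℕ.* count Q xs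
count-concatMap P Q f m blocks []       = sym (ℕₚ.*-zeroʳ m)
count-concatMap P Q f m blocks (x ∷ xs) = begin
  count P (f x ++ concatMap f xs)              ≡⟨ count-++ P (f x) _ ⟩
  count P (f x) ℕ.+ count P (concatMap f xs)   ≡⟨ cong₂ ℕ._+_ (blocks x) (count-concatMap P Q f m blocks xs) ⟩
  m ℕ.* count Q [ x ] ℕ.+ m ℕ.* count Q xs     ≡⟨ sym (ℕₚ.*-distribˡ-+ m (count Q [ x ]) _) ⟩
  m ℕ.* (count Q [ x ] ℕ.+ count Q xs)         ≡⟨ cong (m ℕ.*_) (sym (count-++ Q [ x ] xs)) ⟩
  m ℕ.* count Q (x ∷ xs)                       ∎
  where open ≡-Reasoning

∑-upTo-𝟙-≡ᵇ≤1 : ∀ n a → ∑ (upTo n) (λ i → 𝟙 (i ≡ᵇ a)) ≤ 1ℚ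
∑-upTo-𝟙-≡ᵇ≤1 n a = begin
  ∑ (upTo n) (λ i → 𝟙 (i ≡ᵇ a))   ≡⟨ sym (ℕtoℚ-count (_≡ᵇ a) (upTo n)) ⟩
  ℕtoℚ (count (_≡ᵇ a) (upTo n))   ≤⟨ ℕtoℚ-mono-≤ (count-unique≤1 (Uniqueₚ.upTo⁺ n) (λ i → ≡ᵇ-true⇒≡ i a)) ⟩
  1ℚ                              ∎
  where open ≤-Reasoning

𝟙-any≤ : ∀ (P : A → Bool) xs → 𝟙 (any P xs) ≤ ∑ xs (𝟙 ∘ P)
𝟙-any≤ P []       = ≤-refl
𝟙-any≤ P (x ∷ xs) = ≤-trans (𝟙-∨-≤ (P x) (any P xs)) (+-monoʳ-≤ (𝟙 (P x)) (𝟙-any≤ P xs))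

any⇒count : ∀ (P : A → Bool) xs → any P xs ≡ true → 1 ℕ.≤ count P xs
any⇒count P (x ∷ xs) anyP with P x
... | true  = s≤s z≤n
... | false = any⇒count P xs anyP

any-∈ : ∀ (P : A → Bool) {x xs} → x ∈ xs → P x ≡ true → any P xs ≡ true
any-∈ P {xs = y ∷ ys} (here refl)  Px = cong (_∨ any P ys) Px
any-∈ P {xs = y ∷ ys} (there x∈ys) Px = trans (cong (P y ∨_) (any-∈ P x∈ys Px)) (Boolₚ.∨-zeroʳ (P y))

andL-map : ∀ (f : A → Bool) xs → (∀ x → x ∈ xs → f x ≡ true) → andL (map f xs) ≡ true
andL-map f []       _      = refl
andL-map f (x ∷ xs) allTrue = cong₂ _∧_ (allTrue x (here refl)) (andL-map f xs (λ y y∈ → allTrue y (there y∈)))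

weight : ℚ → List Bool → ℚ
weight q []          = 1ℚ
weight q (true ∷ s)  = q * weight q s
weight q (false ∷ s) = (1ℚ - q) * weight q s

weight-nonNeg : 0ℚ ≤ q → q ≤ 1ℚ → ∀ s → 0ℚ ≤ weight q s
weight-nonNeg 0≤q q≤1 []          = 0≤1
weight-nonNeg 0≤q q≤1 (true ∷ s)  = *-nonNeg 0≤q (weight-nonNeg 0≤q q≤1 s)
weight-nonNeg 0≤q q≤1 (false ∷ s) = *-nonNeg (x≤y⇒0≤y-x q≤1) (weight-nonNeg 0≤q q≤1 s)

countTrue≤length : ∀ s → countTrue s ℕ.≤ length s
countTrue≤length []          = z≤n
countTrue≤length (true ∷ s)  = s≤s (countTrue≤length s)
countTrue≤length (false ∷ s) = ℕₚ.m≤n⇒m≤1+n (countTrue≤length s)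

weight≡ : ∀ q s → weight q s ≡ q ^ℚ countTrue s * (1ℚ - q) ^ℚ (length s ∸ countTrue s)
weight≡ q []          = refl
weight≡ q (true ∷ s)  = trans (cong (q *_) (weight≡ q s)) (sym (*-assoc q _ _))
weight≡ q (false ∷ s) = begin
  (1ℚ - q) * weight q s                                           ≡⟨ cong ((1ℚ - q) *_) (weight≡ q s) ⟩
  (1ℚ - q) * (q ^ℚ countTrue s * (1ℚ - q) ^ℚ (length s ∸ countTrue s)) ≡⟨ *-left-comm (1ℚ - q) (q ^ℚ countTrue s) _ ⟩
  q ^ℚ countTrue s * (1ℚ - q) ^ℚ suc (length s ∸ countTrue s)        ≡⟨ cong (λ m → q ^ℚ countTrue s * (1ℚ - q) ^ℚ m)
                                                                         (sym (ℕₚ.+-∸-assoc 1 (countTrue≤length s))) ⟩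
  q ^ℚ countTrue s * (1ℚ - q) ^ℚ (suc (length s) ∸ countTrue s)      ∎
  where open ≡-Reasoning

-- The graphs on n vertices are the selectors of length numPairs n, so 𝔼 (numPairs n) p
-- is the expectation over G(n,p).
𝔼 : ℕ → ℚ → (List Bool → ℚ) → ℚ
𝔼 k q f = ∑ (allBools k) (λ s → weight q s * f s)

∑-allBools-suc : ∀ k (f : List Bool → ℚ) →
                 ∑ (allBools (suc k)) f ≡ ∑ (allBools k) (λ s → f (true ∷ s) + f (false ∷ s))
∑-allBools-suc k f = trans (∑-concatMap _ (allBools k) f)
  (∑-cong (allBools k) (λ s → cong (f (true ∷ s) +_) (+-identityʳ _)))

length-∈-allBools : ∀ k {s} → s ∈ allBools k → length s ≡ k
length-∈-allBools zero    (here refl) = refl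
length-∈-allBools (suc k) s∈ with find (∈-concatMap⁻ (λ s → (true ∷ s) ∷ (false ∷ s) ∷ []) {xs = allBools k} s∈)
... | s′ , s′∈ , here refl         = cong suc (length-∈-allBools k s′∈)
... | s′ , s′∈ , there (here refl) = cong suc (length-∈-allBools k s′∈)

𝔼-suc : ∀ k q f → 𝔼 (suc k) q f ≡ 𝔼 k q (λ s → q * f (true ∷ s) + (1ℚ - q) * f (false ∷ s))
𝔼-suc k q f = trans (∑-allBools-suc k _) (∑-cong (allBools k) (λ s →
  regroup q (weight q s) (f (true ∷ s)) (f (false ∷ s))))
  where
  regroup : ∀ q w a b → q * w * a + (1ℚ - q) * w * b ≡ w * (q * a + (1ℚ - q) * b)
  regroup = solve 4 (λ q w a b →
    q :* w :* a :+ (con 1ℚ :- q) :* w :* b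
    := w :* (q :* a :+ (con 1ℚ :- q) :* b)) refl

𝔼-cong : ∀ k q {f g} → (∀ s → length s ≡ k → f s ≡ g s) → 𝔼 k q f ≡ 𝔼 k q g
𝔼-cong k q f≗g = ∑-cong-∈ (allBools k) (λ {s} s∈ → cong (weight q s *_) (f≗g s (length-∈-allBools k s∈)))

𝔼-mono-≤ : ∀ k → 0ℚ ≤ q → q ≤ 1ℚ → ∀ {f g} → (∀ s → length s ≡ k → f s ≤ g s) → 𝔼 k q f ≤ 𝔼 k q g
𝔼-mono-≤ k 0≤q q≤1 f≤g = ∑-mono-≤-∈ (allBools k) (λ {s} s∈ →
  *-monoˡ-≤-nonNeg′ (weight-nonNeg 0≤q q≤1 s) (f≤g s (length-∈-allBools k s∈)))

𝔼-+ : ∀ k q f g → 𝔼 k q (λ s → f s + g s) ≡ 𝔼 k q f + 𝔼 k q g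
𝔼-+ k q f g = trans (∑-cong (allBools k) (λ s → *-distribˡ-+ (weight q s) (f s) (g s))) (∑-+ (allBools k) _ _)

𝔼-*ˡ : ∀ k q c f → 𝔼 k q (λ s → c * f s) ≡ c * 𝔼 k q f
𝔼-*ˡ k q c f = trans (∑-cong (allBools k) (λ s → *-left-comm (weight q s) c (f s))) (∑-*ˡ (allBools k) c _)

𝔼-const : ∀ k q c → 𝔼 k q (λ _ → c) ≡ c
𝔼-const zero    q c = trans (+-identityʳ _) (*-identityˡ c)
𝔼-const (suc k) q c = trans (𝔼-suc k q _) (trans (𝔼-cong k q (λ _ _ → convex q c)) (𝔼-const k q c))
  where
  convex : ∀ q c → q * c + (1ℚ - q) * c ≡ c
  convex = solve 2 (λ q c → q :* c :+ (con 1ℚ :- q) :* c := c) refl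

𝔼-∑ : ∀ k q (xs : List A) (F : A → List Bool → ℚ) → 𝔼 k q (λ s → ∑ xs (λ x → F x s)) ≡ ∑ xs (λ x → 𝔼 k q (F x))
𝔼-∑ k q []       F = 𝔼-const k q 0ℚ
𝔼-∑ k q (x ∷ xs) F = trans (𝔼-+ k q (F x) _) (cong (𝔼 k q (F x) +_) (𝔼-∑ k q xs F))

𝔼-variance : ∀ k q (X : List Bool → ℚ) → 𝔼 k q (λ s → (X s - 𝔼 k q X) ²) ≡ 𝔼 k q (λ s → X s ²) - (𝔼 k q X) ²
𝔼-variance k q X = begin
  𝔼 k q (λ s → (X s - μ) ²)                                   ≡⟨ 𝔼-cong k q (λ s _ → expand (X s) μ) ⟩
  𝔼 k q (λ s → X s ² + (- (μ + μ) * X s + μ ²))                ≡⟨ 𝔼-+ k q _ _ ⟩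
  𝔼 k q (λ s → X s ²) + 𝔼 k q (λ s → - (μ + μ) * X s + μ ²)    ≡⟨ cong (𝔼 k q (λ s → X s ²) +_) (𝔼-+ k q _ _) ⟩
  𝔼 k q (λ s → X s ²) + (𝔼 k q (λ s → - (μ + μ) * X s) + 𝔼 k q (λ _ → μ ²))
                                                              ≡⟨ cong₂ (λ a b → 𝔼 k q (λ s → X s ²) + (a + b))
                                                                       (𝔼-*ˡ k q (- (μ + μ)) X) (𝔼-const k q (μ ²)) ⟩
  𝔼 k q (λ s → X s ²) + (- (μ + μ) * μ + μ ²)                  ≡⟨ collect (𝔼 k q (λ s → X s ²)) μ ⟩
  𝔼 k q (λ s → X s ²) - μ ²                                    ∎
  where
  open ≡-Reasoning
  μ = 𝔼 k q X
  expand : ∀ x m → (x - m) * (x - m) ≡ x * x + (- (m + m) * x + m * m)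
  expand = solve 2 (λ x m → (x :- m) :* (x :- m) := x :* x :+ (:- (m :+ m) :* x :+ m :* m)) refl
  collect : ∀ a m → a + (- (m + m) * m + m * m) ≡ a - m * m
  collect = solve 2 (λ a m → a :+ (:- (m :+ m) :* m :+ m :* m) := a :- m :* m) refl

-- A selector s : List Bool chooses the elements of a list at its true positions,
-- as selectEdges does; allSelected P xs s says that every element satisfying P is chosen.
allSelected : (A → Bool) → List A → List Bool → Bool
allSelected P []       s       = true
allSelected P (x ∷ xs) []      = true
allSelected P (x ∷ xs) (b ∷ s) = (b ∨ not (P x)) ∧ allSelected P xs s

allSelected-∨ : ∀ (P Q : A → Bool) xs s →
                allSelected (λ x → P x ∨ Q x) xs s ≡ allSelected P xs s ∧ allSelected Q xs s
allSelected-∨ P Q []       s       = refl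
allSelected-∨ P Q (x ∷ xs) []      = refl
allSelected-∨ P Q (x ∷ xs) (b ∷ s) with b | P x | Q x
... | true  | _     | _     = allSelected-∨ P Q xs s
... | false | true  | _     = refl
... | false | false | true  = sym (Boolₚ.∧-zeroʳ (allSelected P xs s))
... | false | false | false = allSelected-∨ P Q xs s

𝔼-allSelected : ∀ q (P : A → Bool) xs → 𝔼 (length xs) q (𝟙 ∘ allSelected P xs) ≡ q ^ℚ count P xs
𝔼-allSelected q P []       = 𝔼-const 0 q 1ℚ
𝔼-allSelected q P (x ∷ xs) = begin
  𝔼 (suc n) q (𝟙 ∘ allSelected P (x ∷ xs))                             ≡⟨ 𝔼-suc n q _ ⟩
  𝔼 n q (λ s → q * 𝟙 (chosen s) + (1ℚ - q) * 𝟙 (not (P x) ∧ chosen s)) ≡⟨ 𝔼-cong n q (λ s _ → step (P x) (chosen s)) ⟩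
  𝔼 n q (λ s → factor (P x) * 𝟙 (chosen s))                            ≡⟨ 𝔼-*ˡ n q (factor (P x)) _ ⟩
  factor (P x) * 𝔼 n q (𝟙 ∘ chosen)                                    ≡⟨ cong (factor (P x) *_) (𝔼-allSelected q P xs) ⟩
  factor (P x) * q ^ℚ count P xs                                       ≡⟨ absorb (P x) ⟩
  q ^ℚ count P (x ∷ xs)                                                ∎
  where
  open ≡-Reasoning
  n = length xs
  chosen = allSelected P xs
  factor : Bool → ℚ
  factor b = if b then q else 1ℚ
  step : ∀ b a → q * 𝟙 a + (1ℚ - q) * 𝟙 (not b ∧ a) ≡ factor b * 𝟙 a
  step true  a = kill q (𝟙 a)
    where kill : ∀ q y → q * y + (1ℚ - q) * 0ℚ ≡ q * y
          kill = solve 2 (λ q y → q :* y :+ (con 1ℚ :- q) :* con 0ℚ := q :* y) refl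
  step false a = convex q (𝟙 a)
    where convex : ∀ q y → q * y + (1ℚ - q) * y ≡ 1ℚ * y
          convex = solve 2 (λ q y → q :* y :+ (con 1ℚ :- q) :* y := con 1ℚ :* y) refl
  absorb : ∀ b → factor b * q ^ℚ count P xs ≡ q ^ℚ countTrue (b ∷ map P xs)
  absorb true  = refl
  absorb false = *-identityˡ _

𝔼-guarded-allSelected : ∀ q b (P : A → Bool) xs →
                        𝔼 (length xs) q (λ s → 𝟙 (b ∧ allSelected P xs s)) ≡ 𝟙 b * q ^ℚ count P xs
𝔼-guarded-allSelected q b P xs = trans (𝔼-cong (length xs) q (λ s _ → 𝟙-∧ b (allSelected P xs s)))
  (trans (𝔼-*ˡ (length xs) q (𝟙 b) (𝟙 ∘ allSelected P xs)) (cong (𝟙 b *_) (𝔼-allSelected q P xs)))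

𝔼-countTrue-variance : ∀ k q → 𝔼 k q (λ s → (ℕtoℚ (countTrue s) - ℕtoℚ k * q) ²) ≡ ℕtoℚ k * q * (1ℚ - q)
𝔼-countTrue-variance zero    q = base q
  where
  base : ∀ q → 1ℚ * ((0ℚ - 0ℚ * q) * (0ℚ - 0ℚ * q)) + 0ℚ ≡ 0ℚ * q * (1ℚ - q)
  base = solve 1 (λ q →
    con 1ℚ :* ((con 0ℚ :- con 0ℚ :* q) :* (con 0ℚ :- con 0ℚ :* q)) :+ con 0ℚ
    := con 0ℚ :* q :* (con 1ℚ :- q)) refl
𝔼-countTrue-variance (suc k) q = begin
  𝔼 (suc k) q (λ s → (ℕtoℚ (countTrue s) - ℕtoℚ (suc k) * q) ²)
    ≡⟨ 𝔼-suc k q _ ⟩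
  𝔼 k q (λ s → q * (ℕtoℚ (suc (countTrue s)) - ℕtoℚ (suc k) * q) ² + (1ℚ - q) * (ℕtoℚ (countTrue s) - ℕtoℚ (suc k) * q) ²)
    ≡⟨ 𝔼-cong k q (λ s _ → step (countTrue s)) ⟩
  𝔼 k q (λ s → (ℕtoℚ (countTrue s) - ℕtoℚ k * q) ² + q * (1ℚ - q))
    ≡⟨ 𝔼-+ k q _ _ ⟩
  𝔼 k q (λ s → (ℕtoℚ (countTrue s) - ℕtoℚ k * q) ²) + 𝔼 k q (λ _ → q * (1ℚ - q))
    ≡⟨ cong₂ _+_ (𝔼-countTrue-variance k q) (𝔼-const k q _) ⟩
  ℕtoℚ k * q * (1ℚ - q) + q * (1ℚ - q)
    ≡⟨ collect (ℕtoℚ k) q ⟩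
  (1ℚ + ℕtoℚ k) * q * (1ℚ - q)
    ≡⟨ cong (λ m → m * q * (1ℚ - q)) (sym (ℕtoℚ-suc k)) ⟩
  ℕtoℚ (suc k) * q * (1ℚ - q)
    ∎
  where
  open ≡-Reasoning
  identity : ∀ q c k → q * ((1ℚ + c - (1ℚ + k) * q) * (1ℚ + c - (1ℚ + k) * q))
                       + (1ℚ - q) * ((c - (1ℚ + k) * q) * (c - (1ℚ + k) * q))
                       ≡ (c - k * q) * (c - k * q) + q * (1ℚ - q)
  identity = solve 3 (λ q c k →
    q :* ((con 1ℚ :+ c :- (con 1ℚ :+ k) :* q) :* (con 1ℚ :+ c :- (con 1ℚ :+ k) :* q))
      :+ (con 1ℚ :- q) :* ((c :- (con 1ℚ :+ k) :* q) :* (c :- (con 1ℚ :+ k) :* q))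
    := (c :- k :* q) :* (c :- k :* q) :+ q :* (con 1ℚ :- q)) refl
  step : ∀ c → q * (ℕtoℚ (suc c) - ℕtoℚ (suc k) * q) ² + (1ℚ - q) * (ℕtoℚ c - ℕtoℚ (suc k) * q) ²
               ≡ (ℕtoℚ c - ℕtoℚ k * q) ² + q * (1ℚ - q)
  step c = trans (cong₂ (λ a b → q * (a - b * q) ² + (1ℚ - q) * (ℕtoℚ c - b * q) ²) (ℕtoℚ-suc c) (ℕtoℚ-suc k))
                 (identity q (ℕtoℚ c) (ℕtoℚ k))
  collect : ∀ k q → k * q * (1ℚ - q) + q * (1ℚ - q) ≡ (1ℚ + k) * q * (1ℚ - q)
  collect = solve 2 (λ k q →
    k :* q :* (con 1ℚ :- q) :+ q :* (con 1ℚ :- q)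
    := (con 1ℚ :+ k) :* q :* (con 1ℚ :- q)) refl

Pair : Set
Pair = ℕ × ℕ

Triple : Set
Triple = ℕ × ℕ × ℕ

_==_ : Pair → Pair → Bool
(a , b) == (i , j) = (a ≡ᵇ i) ∧ (b ≡ᵇ j)

==⇒≡ : ∀ x y → x == y ≡ true → x ≡ y
==⇒≡ (a , b) (i , j) eq =
  cong₂ _,_ (≡ᵇ-true⇒≡ a i (Boolₚ.∧-conicalˡ (a ≡ᵇ i) _ eq)) (≡ᵇ-true⇒≡ b j (Boolₚ.∧-conicalʳ (a ≡ᵇ i) _ eq))

==-refl : ∀ x → x == x ≡ true
==-refl (a , b) rewrite ≡ᵇ-refl a | ≡ᵇ-refl b = refl

_∈ᵇ_ : Pair → List Pair → Bool
p ∈ᵇ es = any (_== p) es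

pairsOf-unique : ∀ n → Unique (pairsOf n)
pairsOf-unique n = Uniqueₚ.concat⁺ (Allₚ.map⁺ (All.tabulate (λ {j} _ → row-unique j)))
  (AllPairsₚ.map⁺ (AllPairs.map rows-disjoint (Uniqueₚ.upTo⁺ n)))
  where
  row : ℕ → List Pair
  row j = map (λ i → (i , j)) (upTo j)
  row-unique : ∀ j → Unique (row j)
  row-unique j = Uniqueₚ.map⁺ (cong proj₁) (Uniqueₚ.upTo⁺ j)
  column : ∀ {j v} → v ∈ row j → proj₂ v ≡ j
  column v∈row with ∈-map⁻ _ v∈row
  ... | _ , _ , refl = refl
  rows-disjoint : ∀ {j j′} → j ≢ j′ → Disjoint (row j) (row j′)
  rows-disjoint j≢j′ (v∈j , v∈j′) = j≢j′ (trans (sym (column v∈j)) (column v∈j′))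

count-==-pairsOf≤1 : ∀ n p → count (_== p) (pairsOf n) ℕ.≤ 1
count-==-pairsOf≤1 n p = count-unique≤1 (pairsOf-unique n) (λ x → ==⇒≡ x p)

pair∈pairsOf : ∀ {n i j} → i ℕ.< j → j ℕ.< n → (i , j) ∈ pairsOf n
pair∈pairsOf {j = j} i<j j<n = ∈-concatMap⁺ _
  (Any.map (λ { refl → ∈-map⁺ (λ i → (i , j)) (∈-upTo⁺ i<j) }) (∈-upTo⁺ j<n))

count-selectEdges≤ : ∀ (P : Pair → Bool) ks s → count P (selectEdges ks s) ℕ.≤ count P ks
count-selectEdges≤ P []       s           = z≤n
count-selectEdges≤ P (k ∷ ks) []          = z≤n
count-selectEdges≤ P (k ∷ ks) (true ∷ s)  with P k
... | true  = s≤s (count-selectEdges≤ P ks s)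
... | false = count-selectEdges≤ P ks s
count-selectEdges≤ P (k ∷ ks) (false ∷ s) with P k
... | true  = ℕₚ.m≤n⇒m≤1+n (count-selectEdges≤ P ks s)
... | false = count-selectEdges≤ P ks s

length-selectEdges : ∀ (ks : List Pair) s → length ks ≡ length s → length (selectEdges ks s) ≡ countTrue s
length-selectEdges []       []          _          = refl
length-selectEdges (k ∷ ks) (true ∷ s)  ∣ks∣≡∣s∣ = cong suc (length-selectEdges ks s (ℕₚ.suc-injective ∣ks∣≡∣s∣))
length-selectEdges (k ∷ ks) (false ∷ s) ∣ks∣≡∣s∣ = length-selectEdges ks s (ℕₚ.suc-injective ∣ks∣≡∣s∣)

count≡0⇒allSelected : ∀ (P : A → Bool) xs s → count P xs ≡ 0 → allSelected P xs s ≡ true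
count≡0⇒allSelected P []       s       _    = refl
count≡0⇒allSelected P (x ∷ xs) []      _    = refl
count≡0⇒allSelected P (x ∷ xs) (b ∷ s) none with P x
... | false = trans (cong (_∧ allSelected P xs s) (Boolₚ.∨-zeroʳ b)) (count≡0⇒allSelected P xs s none)

-- Selection is by position: p ∈ selectEdges ks s only says that some occurrence of p in ks is chosen.
unique⇒allSelected : ∀ ks s p → p ∈ᵇ selectEdges ks s ≡ true → count (_== p) ks ℕ.≤ 1 →
                     allSelected (_== p) ks s ≡ true
unique⇒allSelected []       s           p _  _     = refl
unique⇒allSelected (k ∷ ks) (true ∷ s)  p p∈ once with k == p
... | true  = count≡0⇒allSelected (_== p) ks s (ℕₚ.n≤0⇒n≡0 (ℕₚ.≤-pred once))
... | false = unique⇒allSelected ks s p p∈ once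
unique⇒allSelected (k ∷ ks) (false ∷ s) p p∈ once with k == p
... | true  = ⊥-elim (ℕₚ.<-irrefl refl (ℕₚ.≤-trans (s≤s (ℕₚ.≤-trans (any⇒count (_== p) (selectEdges ks s) p∈)
                                                     (count-selectEdges≤ (_== p) ks s))) once))
... | false = unique⇒allSelected ks s p p∈ once

numPairs-suc : ∀ n → numPairs (suc n) ≡ numPairs n ℕ.+ n
numPairs-suc n = begin
  length (concatMap row (upTo (suc n)))                  ≡⟨ cong (length ∘ concatMap row) (sym (Listₚ.upTo-∷ʳ n)) ⟩
  length (concatMap row (upTo n ++ [ n ]))               ≡⟨ cong length (Listₚ.concatMap-++ row (upTo n) [ n ]) ⟩
  length (concatMap row (upTo n) ++ concatMap row [ n ]) ≡⟨ Listₚ.length-++ (concatMap row (upTo n)) ⟩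
  numPairs n ℕ.+ length (row n ++ [])                    ≡⟨ cong (numPairs n ℕ.+_) (trans (cong length (Listₚ.++-identityʳ (row n)))
                                                              (trans (Listₚ.length-map _ (upTo n)) (Listₚ.length-upTo n))) ⟩
  numPairs n ℕ.+ n                                       ∎
  where
  open ≡-Reasoning
  row : ℕ → List Pair
  row j = map (λ i → (i , j)) (upTo j)

2*numPairs+n≡n*n : ∀ n → 2 ℕ.* numPairs n ℕ.+ n ≡ n ℕ.* n
2*numPairs+n≡n*n zero    = refl
2*numPairs+n≡n*n (suc n) = begin
  2 ℕ.* numPairs (suc n) ℕ.+ suc n           ≡⟨ cong (λ m → 2 ℕ.* m ℕ.+ suc n) (numPairs-suc n) ⟩
  2 ℕ.* (numPairs n ℕ.+ n) ℕ.+ suc n         ≡⟨ regroup (numPairs n) n ⟩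
  (2 ℕ.* numPairs n ℕ.+ n) ℕ.+ (2 ℕ.* n ℕ.+ 1) ≡⟨ cong (ℕ._+ (2 ℕ.* n ℕ.+ 1)) (2*numPairs+n≡n*n n) ⟩
  n ℕ.* n ℕ.+ (2 ℕ.* n ℕ.+ 1)                ≡⟨ square n ⟩
  suc n ℕ.* suc n                            ∎
  where
  open ≡-Reasoning
  regroup : ∀ N n → 2 ℕ.* (N ℕ.+ n) ℕ.+ suc n ≡ (2 ℕ.* N ℕ.+ n) ℕ.+ (2 ℕ.* n ℕ.+ 1)
  regroup = ℕSolver.solve-∀
  square : ∀ n → n ℕ.* n ℕ.+ (2 ℕ.* n ℕ.+ 1) ≡ suc n ℕ.* suc n
  square = ℕSolver.solve-∀

n²≤4*numPairs : ∀ n → 2 ℕ.≤ n → ℕtoℚ n ² ≤ ℕtoℚ 4 * ℕtoℚ (numPairs n)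
n²≤4*numPairs n 2≤n = begin
  ℕtoℚ n ²                     ≡⟨ sym (ℕtoℚ-* n n) ⟩
  ℕtoℚ (n ℕ.* n)               ≤⟨ ℕtoℚ-mono-≤ n*n≤4N ⟩
  ℕtoℚ (4 ℕ.* numPairs n)      ≡⟨ ℕtoℚ-* 4 (numPairs n) ⟩
  ℕtoℚ 4 * ℕtoℚ (numPairs n)   ∎
  where
  open ≤-Reasoning
  N = numPairs n
  double : ∀ N n → 2 ℕ.* (2 ℕ.* N ℕ.+ n) ≡ 4 ℕ.* N ℕ.+ 2 ℕ.* n
  double = ℕSolver.solve-∀
  n*n≤4N : n ℕ.* n ℕ.≤ 4 ℕ.* N
  n*n≤4N = ℕₚ.+-cancelʳ-≤ (2 ℕ.* n) (n ℕ.* n) (4 ℕ.* N) (ℕₚ.≤-trans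
    (ℕₚ.+-monoʳ-≤ (n ℕ.* n) (ℕₚ.*-monoˡ-≤ n 2≤n))
    (ℕₚ.≤-reflexive (trans (sym (cong (n ℕ.* n ℕ.+_) (ℕₚ.+-identityʳ (n ℕ.* n))))
                    (trans (cong (2 ℕ.*_) (sym (2*numPairs+n≡n*n n))) (double N n)))))

side₁ side₂ side₃ : Triple → Pair
side₁ (i , j , k) = (i , j)
side₂ (i , j , k) = (i , k)
side₃ (i , j , k) = (j , k)

isSide : Triple → Pair → Bool
isSide t x = x == side₁ t ∨ (x == side₂ t ∨ x == side₃ t)

shareSide : Triple → Triple → Bool
shareSide t t′ = isSide t (side₁ t′) ∨ (isSide t (side₂ t′) ∨ isSide t (side₃ t′))

increasing : ℕ → Triple → Bool
increasing n (i , j , k) = (i <ᵇ j) ∧ ((j <ᵇ k) ∧ (k <ᵇ n))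

cube : ℕ → List Triple
cube n = concatMap (λ k → concatMap (λ j → map (λ i → (i , j , k)) (upTo n)) (upTo n)) (upTo n)

increasing⇒< : ∀ n i j k → increasing n (i , j , k) ≡ true → i ℕ.< j × j ℕ.< k × k ℕ.< n
increasing⇒< n i j k inc =
  <ᵇ-true⇒< i j (Boolₚ.∧-conicalˡ (i <ᵇ j) _ inc) ,
  <ᵇ-true⇒< j k (Boolₚ.∧-conicalˡ (j <ᵇ k) _ rest) ,
  <ᵇ-true⇒< k n (Boolₚ.∧-conicalʳ (j <ᵇ k) _ rest)
  where rest = Boolₚ.∧-conicalʳ (i <ᵇ j) _ inc

==-disjoint : ∀ {x y} → x ≢ y → ∀ z → (z == x) ∧ (z == y) ≡ false
==-disjoint {x} {y} x≢y z with z == x in zx | z == y in zy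
... | true  | true  = ⊥-elim (x≢y (trans (sym (==⇒≡ z x zx)) (==⇒≡ z y zy)))
... | true  | false = refl
... | false | _     = refl

count-isSide≥3 : ∀ n t → increasing n t ≡ true → 3 ℕ.≤ count (isSide t) (pairsOf n)
count-isSide≥3 n t@(i , j , k) inc = begin
  3                                                       ≤⟨ ℕₚ.+-mono-≤ (hasPair (ℕₚ.<-trans j<k k<n) i<j)
                                                              (ℕₚ.+-mono-≤ (hasPair k<n (ℕₚ.<-trans i<j j<k)) (hasPair k<n j<k)) ⟩
  count (_== side₁ t) keys ℕ.+ (count (_== side₂ t) keys ℕ.+ count (_== side₃ t) keys)
                                                          ≡⟨ sym (cong (count (_== side₁ t) keys ℕ.+_)
                                                                (count-∨ _ _ keys (==-disjoint side₂≢side₃))) ⟩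
  count (_== side₁ t) keys ℕ.+ count (λ x → x == side₂ t ∨ x == side₃ t) keys
                                                          ≡⟨ sym (count-∨ _ _ keys (λ z →
                                                                trans (Boolₚ.∧-distribˡ-∨ (z == side₁ t) _ _)
                                                                  (cong₂ _∨_ (==-disjoint side₁≢side₂ z) (==-disjoint side₁≢side₃ z)))) ⟩
  count (isSide t) keys                                   ∎
  where
  open ℕₚ.≤-Reasoning
  keys = pairsOf n
  bounds = increasing⇒< n i j k inc
  i<j = proj₁ bounds
  j<k = proj₁ (proj₂ bounds)
  k<n = proj₂ (proj₂ bounds)
  hasPair : ∀ {a b} → b ℕ.< n → a ℕ.< b → 1 ℕ.≤ count (_== (a , b)) keys
  hasPair {a} {b} b<n a<b = count-∈ (_== (a , b)) (pair∈pairsOf a<b b<n) (==-refl (a , b))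
  side₁≢side₂ : side₁ t ≢ side₂ t
  side₁≢side₂ eq = ℕₚ.<-irrefl (cong proj₂ eq) j<k
  side₁≢side₃ : side₁ t ≢ side₃ t
  side₁≢side₃ eq = ℕₚ.<-irrefl (cong proj₁ eq) i<j
  side₂≢side₃ : side₂ t ≢ side₃ t
  side₂≢side₃ eq = ℕₚ.<-irrefl (cong proj₁ eq) i<j

isSide-sound : ∀ t x → isSide t x ≡ true → x ≡ side₁ t ⊎ (x ≡ side₂ t ⊎ x ≡ side₃ t)
isSide-sound t x onSide with ∨≡true⇒ onSide
... | inj₁ e = inj₁ (==⇒≡ x _ e)
... | inj₂ e with ∨≡true⇒ e
...   | inj₁ e′ = inj₂ (inj₁ (==⇒≡ x _ e′))
...   | inj₂ e′ = inj₂ (inj₂ (==⇒≡ x _ e′))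

shareSide-false : ∀ t t′ → shareSide t t′ ≡ false → ∀ x → isSide t x ∧ isSide t′ x ≡ false
shareSide-false t t′ noShare x with isSide t′ x in onT′
... | false = Boolₚ.∧-zeroʳ (isSide t x)
... | true  = trans (Boolₚ.∧-identityʳ (isSide t x)) (notOnT (isSide-sound t′ x onT′))
  where
  notOnT : x ≡ side₁ t′ ⊎ (x ≡ side₂ t′ ⊎ x ≡ side₃ t′) → isSide t x ≡ false
  notOnT (inj₁ refl)        = Boolₚ.∨-conicalˡ _ _ noShare
  notOnT (inj₂ (inj₁ refl)) = Boolₚ.∨-conicalˡ _ (isSide t (side₃ t′)) (Boolₚ.∨-conicalʳ (isSide t (side₁ t′)) _ noShare)
  notOnT (inj₂ (inj₂ refl)) = Boolₚ.∨-conicalʳ (isSide t (side₂ t′)) _ (Boolₚ.∨-conicalʳ (isSide t (side₁ t′)) _ noShare)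

∈-triplesOf⁻ : ∀ n {i j k} → (i , j , k) ∈ triplesOf n → i ℕ.< j × j ℕ.< k × k ℕ.< n
∈-triplesOf⁻ n t∈ with find (∈-concatMap⁻ (λ k → concatMap (λ j → map (λ i → (i , j , k)) (upTo j)) (upTo k)) {xs = upTo n} t∈)
... | k , k∈ , t∈k with find (∈-concatMap⁻ (λ j → map (λ i → (i , j , k)) (upTo j)) {xs = upTo k} t∈k)
...   | j , j∈ , t∈j with ∈-map⁻ (λ i → (i , j , k)) t∈j
...     | i , i∈ , refl = ∈-upTo⁻ i∈ , ∈-upTo⁻ j∈ , ∈-upTo⁻ k∈

∈-cube⁺ : ∀ {n i j k} → i ℕ.< n → j ℕ.< n → k ℕ.< n → (i , j , k) ∈ cube n
∈-cube⁺ {n} {i} {j} {k} i<n j<n k<n =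
  ∈-concatMap⁺ (λ k → concatMap (λ j → map (λ i → (i , j , k)) (upTo n)) (upTo n))
    (lose (∈-upTo⁺ k<n) (∈-concatMap⁺ (λ j → map (λ i → (i , j , k)) (upTo n))
      (lose (∈-upTo⁺ j<n) (∈-map⁺ (λ i → (i , j , k)) (∈-upTo⁺ i<n)))))

isSide-side₁ : ∀ t → isSide t (side₁ t) ≡ true
isSide-side₁ t = cong (_∨ (side₁ t == side₂ t ∨ side₁ t == side₃ t)) (==-refl (side₁ t))

isSide-side₂ : ∀ t → isSide t (side₂ t) ≡ true
isSide-side₂ t = trans (cong (λ b → (side₂ t == side₁ t) ∨ (b ∨ (side₂ t == side₃ t))) (==-refl (side₂ t)))
                       (Boolₚ.∨-zeroʳ (side₂ t == side₁ t))

∑-cube : ∀ n (f : Triple → ℚ) → ∑ (cube n) f ≡ ∑ (upTo n) (λ k → ∑ (upTo n) (λ j → ∑ (upTo n) (λ i → f (i , j , k))))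
∑-cube n f = trans (∑-concatMap _ (upTo n) f) (∑-cong (upTo n) (λ k →
  trans (∑-concatMap _ (upTo n) f) (∑-cong (upTo n) (λ j → ∑-map _ (upTo n) f))))

∑-cube-≤ : ∀ n {f : Triple → ℚ} → (∀ t → f t ≤ c) → ∑ (cube n) f ≤ ℕtoℚ n * (ℕtoℚ n * (ℕtoℚ n * c))
∑-cube-≤ n f≤c = ≤-trans (≤-reflexive (∑-cube n _))
  (∑-upTo-≤ n (λ k → ∑-upTo-≤ n (λ j → ∑-upTo-≤ n (λ i → f≤c _))))

∑∑-upTo-𝟙-==≤1 : ∀ n p → ∑ (upTo n) (λ j → ∑ (upTo n) (λ i → 𝟙 ((i , j) == p))) ≤ 1ℚ
∑∑-upTo-𝟙-==≤1 n (a , b) = begin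
  ∑ (upTo n) (λ j → ∑ (upTo n) (λ i → 𝟙 ((i ≡ᵇ a) ∧ (j ≡ᵇ b))))
    ≡⟨ ∑-cong (upTo n) (λ j → trans (∑-cong (upTo n) (λ i → 𝟙-∧ (i ≡ᵇ a) (j ≡ᵇ b))) (∑-*ʳ (upTo n) _ _)) ⟩
  ∑ (upTo n) (λ j → ∑ (upTo n) (λ i → 𝟙 (i ≡ᵇ a)) * 𝟙 (j ≡ᵇ b))
    ≤⟨ ∑-mono-≤ (upTo n) (λ j → *-monoʳ-≤-nonNeg′ (𝟙-nonNeg (j ≡ᵇ b)) (∑-upTo-𝟙-≡ᵇ≤1 n a)) ⟩
  ∑ (upTo n) (λ j → 1ℚ * 𝟙 (j ≡ᵇ b))
    ≡⟨ ∑-cong (upTo n) (λ j → *-identityˡ _) ⟩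
  ∑ (upTo n) (λ j → 𝟙 (j ≡ᵇ b))
    ≤⟨ ∑-upTo-𝟙-≡ᵇ≤1 n b ⟩
  1ℚ ∎
  where open ≤-Reasoning

∑-cube-side₁≤ : ∀ n p → ∑ (cube n) (λ t → 𝟙 (side₁ t == p)) ≤ ℕtoℚ n
∑-cube-side₁≤ n p = ≤-trans (≤-reflexive (∑-cube n _))
  (≤-trans (∑-upTo-≤ n (λ k → ∑∑-upTo-𝟙-==≤1 n p)) (≤-reflexive (*-identityʳ _)))

∑-cube-side₂≤ : ∀ n p → ∑ (cube n) (λ t → 𝟙 (side₂ t == p)) ≤ ℕtoℚ n
∑-cube-side₂≤ n p = ≤-trans (≤-reflexive (trans (∑-cube n _) (∑-comm (upTo n) (upTo n) _)))
  (≤-trans (∑-upTo-≤ n (λ j → ∑∑-upTo-𝟙-==≤1 n p)) (≤-reflexive (*-identityʳ _)))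

∑-cube-side₃≤ : ∀ n p → ∑ (cube n) (λ t → 𝟙 (side₃ t == p)) ≤ ℕtoℚ n
∑-cube-side₃≤ n p = begin
  ∑ (cube n) (λ t → 𝟙 (side₃ t == p))
    ≡⟨ ∑-cube n _ ⟩
  ∑ (upTo n) (λ k → ∑ (upTo n) (λ j → ∑ (upTo n) (λ _ → 𝟙 ((j , k) == p))))
    ≡⟨ ∑-cong (upTo n) (λ k → ∑-cong (upTo n) (λ j → ∑-upTo-const n (𝟙 ((j , k) == p)))) ⟩
  ∑ (upTo n) (λ k → ∑ (upTo n) (λ j → ℕtoℚ n * 𝟙 ((j , k) == p)))
    ≡⟨ trans (∑-cong (upTo n) (λ k → ∑-*ˡ (upTo n) (ℕtoℚ n) _)) (∑-*ˡ (upTo n) (ℕtoℚ n) _) ⟩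
  ℕtoℚ n * ∑ (upTo n) (λ k → ∑ (upTo n) (λ j → 𝟙 ((j , k) == p)))
    ≤⟨ *-monoˡ-≤-nonNeg′ (ℕtoℚ-nonNeg n) (∑∑-upTo-𝟙-==≤1 n p) ⟩
  ℕtoℚ n * 1ℚ
    ≡⟨ *-identityʳ _ ⟩
  ℕtoℚ n ∎
  where open ≤-Reasoning

∑-cube-isSide≤ : ∀ n t (side : Triple → Pair) → (∀ p → ∑ (cube n) (λ t′ → 𝟙 (side t′ == p)) ≤ ℕtoℚ n) →
                 ∑ (cube n) (λ t′ → 𝟙 (isSide t (side t′))) ≤ ℕtoℚ 3 * ℕtoℚ n
∑-cube-isSide≤ n t side bound = begin
  ∑ (cube n) (λ t′ → 𝟙 (isSide t (side t′)))
    ≤⟨ ∑-mono-≤ (cube n) (λ t′ → 𝟙-∨₃-≤ (side t′ == side₁ t) (side t′ == side₂ t) (side t′ == side₃ t)) ⟩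
  ∑ (cube n) (λ t′ → 𝟙 (side t′ == side₁ t) + (𝟙 (side t′ == side₂ t) + 𝟙 (side t′ == side₃ t)))
    ≡⟨ ∑-+₃ (cube n) _ _ _ ⟩
  ∑ (cube n) (λ t′ → 𝟙 (side t′ == side₁ t))
    + (∑ (cube n) (λ t′ → 𝟙 (side t′ == side₂ t)) + ∑ (cube n) (λ t′ → 𝟙 (side t′ == side₃ t)))
    ≤⟨ +-mono-≤ (bound (side₁ t)) (+-mono-≤ (bound (side₂ t)) (bound (side₃ t))) ⟩
  ℕtoℚ n + (ℕtoℚ n + ℕtoℚ n)
    ≡⟨ triple (ℕtoℚ n) ⟩
  ℕtoℚ 3 * ℕtoℚ n ∎
  where
  open ≤-Reasoning
  triple : ∀ x → x + (x + x) ≡ ℕtoℚ 3 * x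
  triple = solve 1 (λ x → x :+ (x :+ x) := con (ℕtoℚ 3) :* x) refl

∑-cube-shareSide≤ : ∀ n t → ∑ (cube n) (𝟙 ∘ shareSide t) ≤ ℕtoℚ 9 * ℕtoℚ n
∑-cube-shareSide≤ n t = begin
  ∑ (cube n) (𝟙 ∘ shareSide t)
    ≤⟨ ∑-mono-≤ (cube n) (λ t′ → 𝟙-∨₃-≤ (isSide t (side₁ t′)) (isSide t (side₂ t′)) (isSide t (side₃ t′))) ⟩
  ∑ (cube n) (λ t′ → 𝟙 (isSide t (side₁ t′)) + (𝟙 (isSide t (side₂ t′)) + 𝟙 (isSide t (side₃ t′))))
    ≡⟨ ∑-+₃ (cube n) _ _ _ ⟩
  ∑ (cube n) (λ t′ → 𝟙 (isSide t (side₁ t′)))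
    + (∑ (cube n) (λ t′ → 𝟙 (isSide t (side₂ t′))) + ∑ (cube n) (λ t′ → 𝟙 (isSide t (side₃ t′))))
    ≤⟨ +-mono-≤ (∑-cube-isSide≤ n t side₁ (∑-cube-side₁≤ n))
         (+-mono-≤ (∑-cube-isSide≤ n t side₂ (∑-cube-side₂≤ n)) (∑-cube-isSide≤ n t side₃ (∑-cube-side₃≤ n))) ⟩
  ℕtoℚ 3 * ℕtoℚ n + (ℕtoℚ 3 * ℕtoℚ n + ℕtoℚ 3 * ℕtoℚ n)
    ≡⟨ triple (ℕtoℚ n) ⟩
  ℕtoℚ 9 * ℕtoℚ n ∎
  where
  open ≤-Reasoning
  triple : ∀ x → ℕtoℚ 3 * x + (ℕtoℚ 3 * x + ℕtoℚ 3 * x) ≡ ℕtoℚ 9 * x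
  triple = solve 1 (λ x →
    con (ℕtoℚ 3) :* x :+ (con (ℕtoℚ 3) :* x :+ con (ℕtoℚ 3) :* x)
    := con (ℕtoℚ 9) :* x) refl

-- Moments of the triangle count

triangleIn : ℕ → List Bool → Triple → Bool
triangleIn n s t = increasing n t ∧ allSelected (isSide t) (pairsOf n) s

triangles : ℕ → List Bool → ℚ
triangles n s = ∑ (cube n) (𝟙 ∘ triangleIn n s)

triangles-nonNeg : ∀ n s → 0ℚ ≤ triangles n s
triangles-nonNeg n s = ∑-nonNeg (cube n) (𝟙-nonNeg ∘ triangleIn n s)

triangleIn-∧ : ∀ n s t t′ → triangleIn n s t ∧ triangleIn n s t′ ≡
               (increasing n t ∧ increasing n t′) ∧ allSelected (λ x → isSide t x ∨ isSide t′ x) (pairsOf n) s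
triangleIn-∧ n s t t′ = trans (∧-interchange (increasing n t) (increasing n t′) _ _)
  (cong ((increasing n t ∧ increasing n t′) ∧_) (sym (allSelected-∨ (isSide t) (isSide t′) (pairsOf n) s)))

𝔼-triangles : ∀ n q → 𝔼 (numPairs n) q (triangles n) ≡
              ∑ (cube n) (λ t → 𝟙 (increasing n t) * q ^ℚ count (isSide t) (pairsOf n))
𝔼-triangles n q = trans (𝔼-∑ (numPairs n) q (cube n) (λ t s → 𝟙 (triangleIn n s t)))
  (∑-cong (cube n) (λ t → 𝔼-guarded-allSelected q (increasing n t) (isSide t) (pairsOf n)))

𝔼-triangles² : ∀ n q → 𝔼 (numPairs n) q (λ s → triangles n s ²) ≡
               ∑ (cube n) (λ t → ∑ (cube n) (λ t′ →
                 𝟙 (increasing n t ∧ increasing n t′) * q ^ℚ count (λ x → isSide t x ∨ isSide t′ x) (pairsOf n)))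
𝔼-triangles² n q = begin
  𝔼 N q (λ s → triangles n s ²)
    ≡⟨ 𝔼-cong N q (λ s _ → ∑-² (cube n) (𝟙 ∘ triangleIn n s)) ⟩
  𝔼 N q (λ s → ∑ (cube n) (λ t → ∑ (cube n) (λ t′ → 𝟙 (triangleIn n s t) * 𝟙 (triangleIn n s t′))))
    ≡⟨ 𝔼-∑ N q (cube n) _ ⟩
  ∑ (cube n) (λ t → 𝔼 N q (λ s → ∑ (cube n) (λ t′ → 𝟙 (triangleIn n s t) * 𝟙 (triangleIn n s t′))))
    ≡⟨ ∑-cong (cube n) (λ t → trans (𝔼-∑ N q (cube n) _) (∑-cong (cube n) (λ t′ → pair t t′))) ⟩
  ∑ (cube n) (λ t → ∑ (cube n) (λ t′ →
    𝟙 (increasing n t ∧ increasing n t′) * q ^ℚ count (λ x → isSide t x ∨ isSide t′ x) (pairsOf n)))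
    ∎
  where
  open ≡-Reasoning
  N = numPairs n
  pair : ∀ t t′ → 𝔼 N q (λ s → 𝟙 (triangleIn n s t) * 𝟙 (triangleIn n s t′)) ≡
                  𝟙 (increasing n t ∧ increasing n t′) * q ^ℚ count (λ x → isSide t x ∨ isSide t′ x) (pairsOf n)
  pair t t′ = trans (𝔼-cong N q (λ s _ → trans (sym (𝟙-∧ (triangleIn n s t) _)) (cong 𝟙 (triangleIn-∧ n s t t′))))
                    (𝔼-guarded-allSelected q (increasing n t ∧ increasing n t′) (λ x → isSide t x ∨ isSide t′ x) (pairsOf n))

𝔼-triangles≤ : ∀ n → 0ℚ ≤ q → q ≤ 1ℚ → 𝔼 (numPairs n) q (triangles n) ≤ (ℕtoℚ n * q) ³
𝔼-triangles≤ {q} n 0≤q q≤1 = begin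
  𝔼 (numPairs n) q (triangles n)                                           ≡⟨ 𝔼-triangles n q ⟩
  ∑ (cube n) (λ t → 𝟙 (increasing n t) * q ^ℚ count (isSide t) (pairsOf n)) ≤⟨ ∑-cube-≤ n term≤ ⟩
  ℕtoℚ n * (ℕtoℚ n * (ℕtoℚ n * q ^ℚ 3))                                    ≡⟨ regroup (ℕtoℚ n) q ⟩
  (ℕtoℚ n * q) ³                                                           ∎
  where
  open ≤-Reasoning
  term≤ : ∀ t → 𝟙 (increasing n t) * q ^ℚ count (isSide t) (pairsOf n) ≤ q ^ℚ 3
  term≤ t with increasing n t in inc
  ... | true  = ≤-trans (≤-reflexive (*-identityˡ (q ^ℚ count (isSide t) (pairsOf n))))
                        (^ℚ-antitone 0≤q q≤1 (count-isSide≥3 n t inc))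
  ... | false = ≤-trans (≤-reflexive (*-zeroˡ (q ^ℚ count (isSide t) (pairsOf n)))) (^ℚ-nonNeg 0≤q 3)
  regroup : ∀ x q → x * (x * (x * (q * (q * (q * 1ℚ))))) ≡ (x * q) * ((x * q) * (x * q))
  regroup = solve 2 (λ x q →
    x :* (x :* (x :* (q :* (q :* (q :* con 1ℚ)))))
    := (x :* q) :* ((x :* q) :* (x :* q))) refl

covariance≤ : ∀ n → 0ℚ ≤ q → q ≤ 1ℚ → ∀ t t′ →
  𝟙 (increasing n t ∧ increasing n t′) * q ^ℚ count (λ x → isSide t x ∨ isSide t′ x) (pairsOf n)
  - 𝟙 (increasing n t) * q ^ℚ count (isSide t) (pairsOf n) * (𝟙 (increasing n t′) * q ^ℚ count (isSide t′) (pairsOf n))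
  ≤ 𝟙 (shareSide t t′) * q ^ℚ 3
covariance≤ {q} n 0≤q q≤1 t t′ with increasing n t in inc | increasing n t′ in inc′ | shareSide t t′ in share
... | false | b     | s     = ≤-trans (≤-reflexive (vanish (q ^ℚ count (λ x → isSide t x ∨ isSide t′ x) (pairsOf n))
                                                           (q ^ℚ count (isSide t) (pairsOf n))
                                                           (𝟙 b * q ^ℚ count (isSide t′) (pairsOf n))))
                                  (*-nonNeg (𝟙-nonNeg s) (^ℚ-nonNeg 0≤q 3))
  where
  vanish : ∀ x y z → 0ℚ * x - 0ℚ * y * z ≡ 0ℚ
  vanish = solve 3 (λ x y z → con 0ℚ :* x :- con 0ℚ :* y :* z := con 0ℚ) refl
... | true  | false | s     = ≤-trans (≤-reflexive (vanish (q ^ℚ count (λ x → isSide t x ∨ isSide t′ x) (pairsOf n))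
                                                           (q ^ℚ count (isSide t) (pairsOf n))
                                                           (q ^ℚ count (isSide t′) (pairsOf n))))
                                  (*-nonNeg (𝟙-nonNeg s) (^ℚ-nonNeg 0≤q 3))
  where
  vanish : ∀ x y z → 0ℚ * x - 1ℚ * y * (0ℚ * z) ≡ 0ℚ
  vanish = solve 3 (λ x y z → con 0ℚ :* x :- con 1ℚ :* y :* (con 0ℚ :* z) := con 0ℚ) refl
... | true  | true  | false = ≤-reflexive (begin-equality
  1ℚ * q ^ℚ count (λ x → isSide t x ∨ isSide t′ x) keys - 1ℚ * q ^ℚ kₜ * (1ℚ * q ^ℚ kₜ′)
    ≡⟨ cong (λ m → 1ℚ * q ^ℚ m - 1ℚ * q ^ℚ kₜ * (1ℚ * q ^ℚ kₜ′)) (count-∨ (isSide t) (isSide t′) keys (shareSide-false t t′ share)) ⟩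
  1ℚ * q ^ℚ (kₜ ℕ.+ kₜ′) - 1ℚ * q ^ℚ kₜ * (1ℚ * q ^ℚ kₜ′)
    ≡⟨ cong (λ z → 1ℚ * z - 1ℚ * q ^ℚ kₜ * (1ℚ * q ^ℚ kₜ′)) (^ℚ-+ q kₜ kₜ′) ⟩
  1ℚ * (q ^ℚ kₜ * q ^ℚ kₜ′) - 1ℚ * q ^ℚ kₜ * (1ℚ * q ^ℚ kₜ′)
    ≡⟨ vanish (q ^ℚ kₜ) (q ^ℚ kₜ′) ⟩
  0ℚ
    ≡⟨ sym (*-zeroˡ (q ^ℚ 3)) ⟩
  0ℚ * q ^ℚ 3 ∎)
  where
  open ≤-Reasoning
  keys = pairsOf n
  kₜ = count (isSide t) keys
  kₜ′ = count (isSide t′) keys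
  vanish : ∀ x y → 1ℚ * (x * y) - 1ℚ * x * (1ℚ * y) ≡ 0ℚ
  vanish = solve 2 (λ x y → con 1ℚ :* (x :* y) :- con 1ℚ :* x :* (con 1ℚ :* y) := con 0ℚ) refl
... | true  | true  | true  = begin
  1ℚ * q ^ℚ k∪ - 1ℚ * q ^ℚ kₜ * (1ℚ * q ^ℚ kₜ′) ≤⟨ x-y≤x (*-nonNeg (*-nonNeg 0≤1 (^ℚ-nonNeg 0≤q kₜ)) (*-nonNeg 0≤1 (^ℚ-nonNeg 0≤q kₜ′))) ⟩
  1ℚ * q ^ℚ k∪                                ≡⟨ *-identityˡ _ ⟩
  q ^ℚ k∪                                     ≤⟨ ^ℚ-antitone 0≤q q≤1 (ℕₚ.≤-trans (count-isSide≥3 n t inc) kₜ≤k∪) ⟩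
  q ^ℚ 3                                     ≡⟨ sym (*-identityˡ _) ⟩
  1ℚ * q ^ℚ 3                                ∎
  where
  open ≤-Reasoning
  keys = pairsOf n
  k∪ = count (λ x → isSide t x ∨ isSide t′ x) keys
  kₜ = count (isSide t) keys
  kₜ′ = count (isSide t′) keys
  kₜ≤k∪ : kₜ ℕ.≤ k∪
  kₜ≤k∪ = count-mono (isSide t) _ keys (λ x onT → cong (_∨ isSide t′ x) onT)

𝔼-triangles-variance≤ : ∀ n → 0ℚ ≤ q → q ≤ 1ℚ →
  𝔼 (numPairs n) q (λ s → (triangles n s - 𝔼 (numPairs n) q (triangles n)) ²) ≤ ℕtoℚ 9 * (ℕtoℚ n ² * ℕtoℚ n ²) * q ³
𝔼-triangles-variance≤ {q} n 0≤q q≤1 = begin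
  𝔼 N q (λ s → (triangles n s - 𝔼 N q (triangles n)) ²)
    ≡⟨ 𝔼-variance N q (triangles n) ⟩
  𝔼 N q (λ s → triangles n s ²) - (𝔼 N q (triangles n)) ²
    ≡⟨ cong₂ _-_ (𝔼-triangles² n q) (trans (cong _² (𝔼-triangles n q)) (∑-² (cube n) f)) ⟩
  ∑ (cube n) (λ t → ∑ (cube n) (joint t)) - ∑ (cube n) (λ t → ∑ (cube n) (λ t′ → f t * f t′))
    ≡⟨ sym (trans (∑-cong (cube n) (λ t → ∑-sub (cube n) (joint t) _)) (∑-sub (cube n) _ _)) ⟩
  ∑ (cube n) (λ t → ∑ (cube n) (λ t′ → joint t t′ - f t * f t′))
    ≤⟨ ∑-mono-≤ (cube n) (λ t → ∑-mono-≤ (cube n) (covariance≤ n 0≤q q≤1 t)) ⟩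
  ∑ (cube n) (λ t → ∑ (cube n) (λ t′ → 𝟙 (shareSide t t′) * q ^ℚ 3))
    ≤⟨ ∑-cube-≤ n (λ t → ≤-trans (≤-reflexive (∑-*ʳ (cube n) (q ^ℚ 3) (𝟙 ∘ shareSide t)))
                                 (*-monoʳ-≤-nonNeg′ (^ℚ-nonNeg 0≤q 3) (∑-cube-shareSide≤ n t))) ⟩
  ℕtoℚ n * (ℕtoℚ n * (ℕtoℚ n * (ℕtoℚ 9 * ℕtoℚ n * q ^ℚ 3)))
    ≡⟨ regroup (ℕtoℚ n) q ⟩
  ℕtoℚ 9 * (ℕtoℚ n ² * ℕtoℚ n ²) * q ³ ∎
  where
  open ≤-Reasoning
  N = numPairs n
  f : Triple → ℚ
  f t = 𝟙 (increasing n t) * q ^ℚ count (isSide t) (pairsOf n)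
  joint : Triple → Triple → ℚ
  joint t t′ = 𝟙 (increasing n t ∧ increasing n t′) * q ^ℚ count (λ x → isSide t x ∨ isSide t′ x) (pairsOf n)
  regroup : ∀ x q → x * (x * (x * (ℕtoℚ 9 * x * (q * (q * (q * 1ℚ)))))) ≡ ℕtoℚ 9 * ((x * x) * (x * x)) * (q * (q * q))
  regroup = solve 2 (λ x q →
    x :* (x :* (x :* (con (ℕtoℚ 9) :* x :* (q :* (q :* (q :* con 1ℚ))))))
    := con (ℕtoℚ 9) :* ((x :* x) :* (x :* x)) :* (q :* (q :* q))) refl

present : List Pair → Triple → Bool
present es t = (side₁ t ∈ᵇ es) ∧ ((side₂ t ∈ᵇ es) ∧ (side₃ t ∈ᵇ es))

inTriangle : ℕ → List Pair → Pair → Bool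
inTriangle n es x = any (λ t → increasing n t ∧ (present es t ∧ isSide t x)) (cube n)

present⇒allSelected : ∀ n s t → present (edges n s) t ≡ true → allSelected (isSide t) (pairsOf n) s ≡ true
present⇒allSelected n s t pres = begin
  allSelected (isSide t) keys s
    ≡⟨ allSelected-∨ (_== side₁ t) _ keys s ⟩
  allSelected (_== side₁ t) keys s ∧ allSelected (λ x → x == side₂ t ∨ x == side₃ t) keys s
    ≡⟨ cong (allSelected (_== side₁ t) keys s ∧_) (allSelected-∨ (_== side₂ t) (_== side₃ t) keys s) ⟩
  allSelected (_== side₁ t) keys s ∧ (allSelected (_== side₂ t) keys s ∧ allSelected (_== side₃ t) keys s)
    ≡⟨ cong₂ _∧_ (chosen (side₁ t) (Boolₚ.∧-conicalˡ (side₁ t ∈ᵇ edges n s) _ pres))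
                 (cong₂ _∧_ (chosen (side₂ t) (Boolₚ.∧-conicalˡ (side₂ t ∈ᵇ edges n s) _ rest))
                            (chosen (side₃ t) (Boolₚ.∧-conicalʳ (side₂ t ∈ᵇ edges n s) _ rest))) ⟩
  true ∎
  where
  open ≡-Reasoning
  keys = pairsOf n
  rest = Boolₚ.∧-conicalʳ (side₁ t ∈ᵇ edges n s) _ pres
  chosen : ∀ p → p ∈ᵇ edges n s ≡ true → allSelected (_== p) keys s ≡ true
  chosen p p∈ = unique⇒allSelected keys s p p∈ (count-==-pairsOf≤1 n p)

∑-edges-𝟙-isSide≤3 : ∀ n s t → ∑ (edges n s) (𝟙 ∘ isSide t) ≤ ℕtoℚ 3
∑-edges-𝟙-isSide≤3 n s t = begin
  ∑ es (𝟙 ∘ isSide t)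
    ≤⟨ ∑-mono-≤ es (λ x → 𝟙-∨₃-≤ (x == side₁ t) (x == side₂ t) (x == side₃ t)) ⟩
  ∑ es (λ x → 𝟙 (x == side₁ t) + (𝟙 (x == side₂ t) + 𝟙 (x == side₃ t)))
    ≡⟨ ∑-+₃ es _ _ _ ⟩
  ∑ es (𝟙 ∘ (_== side₁ t)) + (∑ es (𝟙 ∘ (_== side₂ t)) + ∑ es (𝟙 ∘ (_== side₃ t)))
    ≤⟨ +-mono-≤ (once (side₁ t)) (+-mono-≤ (once (side₂ t)) (once (side₃ t))) ⟩
  1ℚ + (1ℚ + 1ℚ)
    ≡⟨ refl ⟩
  ℕtoℚ 3 ∎
  where
  open ≤-Reasoning
  es = edges n s
  once : ∀ p → ∑ es (𝟙 ∘ (_== p)) ≤ 1ℚ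
  once p = ≤-trans (≤-reflexive (sym (ℕtoℚ-count (_== p) es)))
    (ℕtoℚ-mono-≤ (ℕₚ.≤-trans (count-selectEdges≤ (_== p) (pairsOf n) s) (count-==-pairsOf≤1 n p)))

edgesInTriangles : ℕ → List Bool → ℕ
edgesInTriangles n s = count (inTriangle n (edges n s)) (edges n s)

freeEdges : ℕ → List Bool → ℕ
freeEdges n s = count (not ∘ inTriangle n (edges n s)) (edges n s)

freeEdges+edgesInTriangles : ∀ n s → freeEdges n s ℕ.+ edgesInTriangles n s ≡ eG n s
freeEdges+edgesInTriangles n s =
  trans (ℕₚ.+-comm (freeEdges n s) _) (count-not (inTriangle n (edges n s)) (edges n s))

edgesInTriangles≤ : ∀ n s → ℕtoℚ (edgesInTriangles n s) ≤ ℕtoℚ 3 * triangles n s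
edgesInTriangles≤ n s = begin
  ℕtoℚ (edgesInTriangles n s)
    ≡⟨ ℕtoℚ-count (inTriangle n es) es ⟩
  ∑ es (𝟙 ∘ inTriangle n es)
    ≤⟨ ∑-mono-≤ es (λ x → 𝟙-any≤ _ (cube n)) ⟩
  ∑ es (λ x → ∑ (cube n) (λ t → 𝟙 (increasing n t ∧ (present es t ∧ isSide t x))))
    ≡⟨ ∑-cong es (λ x → ∑-cong (cube n) (λ t → split t x)) ⟩
  ∑ es (λ x → ∑ (cube n) (λ t → 𝟙 (increasing n t ∧ present es t) * 𝟙 (isSide t x)))
    ≡⟨ ∑-comm es (cube n) _ ⟩
  ∑ (cube n) (λ t → ∑ es (λ x → 𝟙 (increasing n t ∧ present es t) * 𝟙 (isSide t x)))
    ≡⟨ ∑-cong (cube n) (λ t → ∑-*ˡ es (𝟙 (increasing n t ∧ present es t)) (𝟙 ∘ isSide t)) ⟩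
  ∑ (cube n) (λ t → 𝟙 (increasing n t ∧ present es t) * ∑ es (𝟙 ∘ isSide t))
    ≤⟨ ∑-mono-≤ (cube n) (λ t → *-mono-≤-nonNeg′ (𝟙-nonNeg (increasing n t ∧ present es t)) (∑-nonNeg es (𝟙-nonNeg ∘ isSide t))
                                                 (present≤triangleIn t) (∑-edges-𝟙-isSide≤3 n s t)) ⟩
  ∑ (cube n) (λ t → 𝟙 (triangleIn n s t) * ℕtoℚ 3)
    ≡⟨ trans (∑-*ʳ (cube n) (ℕtoℚ 3) (𝟙 ∘ triangleIn n s)) (*-comm (triangles n s) (ℕtoℚ 3)) ⟩
  ℕtoℚ 3 * triangles n s ∎
  where
  open ≤-Reasoning
  es = edges n s
  split : ∀ t x → 𝟙 (increasing n t ∧ (present es t ∧ isSide t x)) ≡ 𝟙 (increasing n t ∧ present es t) * 𝟙 (isSide t x)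
  split t x = trans (cong 𝟙 (sym (Boolₚ.∧-assoc (increasing n t) _ _))) (𝟙-∧ (increasing n t ∧ present es t) _)
  present≤triangleIn : ∀ t → 𝟙 (increasing n t ∧ present es t) ≤ 𝟙 (triangleIn n s t)
  present≤triangleIn t with increasing n t | present es t in pres
  ... | false | _     = ≤-refl
  ... | true  | false = 𝟙-nonNeg (allSelected (isSide t) (pairsOf n) s)
  ... | true  | true  = ≤-reflexive (cong 𝟙 (sym (present⇒allSelected n s t pres)))

-- Gallai colourings

zeroOn : (Pair → Bool) → List (Pair × Fin 3) → Bool
zeroOn M []            = true
zeroOn M ((x , c) ∷ z) = (not (M x) ∨ (toℕ c ≡ᵇ 0)) ∧ zeroOn M z

zeroOn-∈ : ∀ M z {x c} → zeroOn M z ≡ true → (x , c) ∈ z → M x ≡ true → toℕ c ≡ 0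
zeroOn-∈ M ((x , c) ∷ z) ok (here refl) Mx =
  ≡ᵇ-true⇒≡ (toℕ c) 0 (subst (λ b → not b ∨ (toℕ c ≡ᵇ 0) ≡ true) Mx (Boolₚ.∧-conicalˡ _ _ ok))
zeroOn-∈ M ((y , d) ∷ z) ok (there x∈z) Mx =
  zeroOn-∈ M z (Boolₚ.∧-conicalʳ (not (M y) ∨ (toℕ d ≡ᵇ 0)) _ ok) x∈z Mx

colourOf-∈ : ∀ z i j {c} → colourOf z i j ≡ just c → ((i , j) , c) ∈ z
colourOf-∈ (((a , b) , d) ∷ z) i j found with (a , b) == (i , j) in match
... | true  = here (cong₂ _,_ (sym (==⇒≡ (a , b) (i , j) match)) (sym (Maybeₚ.just-injective found)))
... | false = there (colourOf-∈ z i j found)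

∈-zip⁻ˡ : ∀ {x : A} {c : B} xs ys → (x , c) ∈ zip xs ys → x ∈ xs
∈-zip⁻ˡ (x ∷ xs) (y ∷ ys) (here refl)  = here refl
∈-zip⁻ˡ (x ∷ xs) (y ∷ ys) (there x∈zs) = there (∈-zip⁻ˡ xs ys x∈zs)

-- Only the first two sides matter: both get colour 0, so no triangle is rainbow.
notRainbow : ∀ n es cs {i j k} → (i , j , k) ∈ triplesOf n → zeroOn (inTriangle n es) (zip es cs) ≡ true →
             rainbow (zip es cs) (i , j , k) ≡ false
notRainbow n es cs {i} {j} {k} t∈ ok
  with colourOf (zip es cs) i j in found₁ | colourOf (zip es cs) i k in found₂ | colourOf (zip es cs) j k in found₃
... | nothing | _      | _       = refl
... | just x  | nothing | _      = refl
... | just x  | just y | nothing = refl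
... | just x  | just y | just w  =
  cong (λ b → not b ∧ (distinct x w ∧ distinct y w)) (cong₂ _≡ᵇ_ (zero₁ found₁ (isSide-side₁ t)) (zero₁ found₂ (isSide-side₂ t)))
  where
  t = (i , j , k)
  bounds = ∈-triplesOf⁻ n t∈
  i<j = proj₁ bounds
  j<k = proj₁ (proj₂ bounds)
  k<n = proj₂ (proj₂ bounds)
  inEdges : ∀ {a b c} → colourOf (zip es cs) a b ≡ just c → (a , b) ∈ᵇ es ≡ true
  inEdges {a} {b} found = any-∈ (_== (a , b)) (∈-zip⁻ˡ es cs (colourOf-∈ (zip es cs) a b found)) (==-refl (a , b))
  t-present : present es t ≡ true
  t-present = cong₂ _∧_ (inEdges found₁) (cong₂ _∧_ (inEdges found₂) (inEdges found₃))
  t-increasing : increasing n t ≡ true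
  t-increasing = cong₂ _∧_ (<⇒<ᵇ-true i<j) (cong₂ _∧_ (<⇒<ᵇ-true j<k) (<⇒<ᵇ-true k<n))
  t∈cube : t ∈ cube n
  t∈cube = ∈-cube⁺ (ℕₚ.<-trans i<j (ℕₚ.<-trans j<k k<n)) (ℕₚ.<-trans j<k k<n) k<n
  zero₁ : ∀ {a b c} → colourOf (zip es cs) a b ≡ just c → isSide t (a , b) ≡ true → toℕ c ≡ 0
  zero₁ {a} {b} found onT = zeroOn-∈ (inTriangle n es) (zip es cs) ok (colourOf-∈ (zip es cs) a b found)
    (any-∈ (λ t′ → increasing n t′ ∧ (present es t′ ∧ isSide t′ (a , b))) t∈cube
      (cong₂ _∧_ t-increasing (cong₂ _∧_ t-present onT)))

zeroOn⇒isGallai : ∀ n es cs → zeroOn (inTriangle n es) (zip es cs) ≡ true → isGallai n es cs ≡ true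
zeroOn⇒isGallai n es cs ok = andL-map _ (triplesOf n) (λ t t∈ → cong not (notRainbow n es cs t∈ ok))

count-zeroOn : ∀ M (es : List Pair) → count (λ cs → zeroOn M (zip es cs)) (allCols (length es)) ≡ 3 ^ count (not ∘ M) es
count-zeroOn M []       = refl
count-zeroOn M (x ∷ es) = begin
  count (λ cs → zeroOn M (zip (x ∷ es) cs)) (allCols (suc (length es)))
    ≡⟨ count-concatMap _ (λ cs → zeroOn M (zip es cs)) _ (choices (M x)) (λ cs → block (M x) (zeroOn M (zip es cs)))
                       (allCols (length es)) ⟩
  choices (M x) ℕ.* count (λ cs → zeroOn M (zip es cs)) (allCols (length es))
    ≡⟨ cong (choices (M x) ℕ.*_) (count-zeroOn M es) ⟩
  choices (M x) ℕ.* 3 ^ count (not ∘ M) es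
    ≡⟨ absorb (M x) ⟩
  3 ^ count (not ∘ M) (x ∷ es) ∎
  where
  open ≡-Reasoning
  choices : Bool → ℕ
  choices b = if b then 1 else 3
  block : ∀ b z → countTrue (((not b ∨ true) ∧ z) ∷ ((not b ∨ false) ∧ z) ∷ ((not b ∨ false) ∧ z) ∷ [])
                  ≡ choices b ℕ.* countTrue (z ∷ [])
  block true  true  = refl
  block true  false = refl
  block false true  = refl
  block false false = refl
  absorb : ∀ b → choices b ℕ.* 3 ^ count (not ∘ M) es ≡ 3 ^ countTrue (not b ∷ map (not ∘ M) es)
  absorb true  = ℕₚ.*-identityˡ _
  absorb false = refl

3^freeEdges≤gallai : ∀ n s → 3 ^ freeEdges n s ℕ.≤ gallai n s
3^freeEdges≤gallai n s = ℕₚ.≤-trans (ℕₚ.≤-reflexive (sym (count-zeroOn (inTriangle n es) es)))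
  (count-mono _ (isGallai n es) (allCols (length es)) (zeroOn⇒isGallai n es))
  where es = edges n s

-- The bad event

exponent≤ : ∀ u den num e f m → (ℤ.+ den ℤ.- ℤ.+ num) ℤ.* ℤ.+ e ≡ ℤ.+ u → f ℕ.+ m ≡ e →
            den ℕ.* m ℕ.≤ num ℕ.* e → u ℕ.≤ den ℕ.* f
exponent≤ u den num e f m exponent f+m≡e den*m≤num*e = ℕₚ.+-cancelʳ-≤ (den ℕ.* m) u (den ℕ.* f) (begin
  u ℕ.+ den ℕ.* m                ≤⟨ ℕₚ.+-monoʳ-≤ u den*m≤num*e ⟩
  u ℕ.+ num ℕ.* e                ≡⟨ u+num*e ⟩
  den ℕ.* e                      ≡⟨ cong (den ℕ.*_) (sym f+m≡e) ⟩
  den ℕ.* (f ℕ.+ m)              ≡⟨ ℕₚ.*-distribˡ-+ den f m ⟩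
  den ℕ.* f ℕ.+ den ℕ.* m        ∎)
  where
  open ℕₚ.≤-Reasoning
  cancel : ∀ d a x → (d ℤ.- a) ℤ.* x ℤ.+ a ℤ.* x ≡ d ℤ.* x
  cancel = ℤSolver.solve-∀
  u+num*e : u ℕ.+ num ℕ.* e ≡ den ℕ.* e
  u+num*e = ℤₚ.+-injective (trans (ℤₚ.pos-+ u (num ℕ.* e)) (trans (cong₂ ℤ._+_ (sym exponent) (ℤₚ.pos-* num e))
                             (trans (cancel (ℤ.+ den) (ℤ.+ num) (ℤ.+ e)) (sym (ℤₚ.pos-* den e)))))

geq3pow-true : ∀ X den num e f m → 3 ^ f ℕ.≤ X → f ℕ.+ m ≡ e → den ℕ.* m ℕ.≤ num ℕ.* e →
               geq3pow X ((ℤ.+ den ℤ.- ℤ.+ num) ℤ.* ℤ.+ e) den ≡ true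
geq3pow-true X den num e f m 3^f≤X f+m≡e den*m≤num*e with (ℤ.+ den ℤ.- ℤ.+ num) ℤ.* ℤ.+ e in exponent
... | ℤ.+ u = T⇒≡true (ℕₚ.≤⇒≤ᵇ (begin
  3 ^ u               ≤⟨ ℕₚ.^-monoʳ-≤ 3 (exponent≤ u den num e f m exponent f+m≡e den*m≤num*e) ⟩
  3 ^ (den ℕ.* f)     ≡⟨ cong (3 ^_) (ℕₚ.*-comm den f) ⟩
  3 ^ (f ℕ.* den)     ≡⟨ sym (ℕₚ.^-*-assoc 3 f den) ⟩
  (3 ^ f) ^ den       ≤⟨ ℕₚ.^-monoˡ-≤ den 3^f≤X ⟩
  X ^ den             ∎))
  where open ℕₚ.≤-Reasoning
... | -[1+ k ] = T⇒≡true (ℕₚ.≤⇒≤ᵇ (ℕₚ.*-mono-≤ 1≤X^den (ℕₚ.m^n>0 3 (suc k))))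
  where
  open ℕₚ.≤-Reasoning
  1≤X^den : 1 ℕ.≤ X ^ den
  1≤X^den = begin
    1             ≡⟨ sym (ℕₚ.^-zeroˡ den) ⟩
    1 ^ den       ≤⟨ ℕₚ.^-monoˡ-≤ den (ℕₚ.≤-trans (ℕₚ.m^n>0 3 f) 3^f≤X) ⟩
    X ^ den       ∎

bad⇒num*e<den*m : ∀ δ n s num → ↥ δ ≡ ℤ.+ num → goodEvent δ n s ≡ false →
                  num ℕ.* eG n s ℕ.< ↧ₙ δ ℕ.* edgesInTriangles n s
bad⇒num*e<den*m δ n s num ↥δ≡num bad with ↧ₙ δ ℕ.* edgesInTriangles n s ℕₚ.≤? num ℕ.* eG n s
... | no  den*m≰num*e = ℕₚ.≰⇒> den*m≰num*e
... | yes den*m≤num*e = contradiction (trans (sym good) bad) λ ()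
  where
  good : geq3pow (gallai n s) ((ℤ.+ ↧ₙ δ ℤ.- ↥ δ) ℤ.* ℤ.+ eG n s) (↧ₙ δ) ≡ true
  good rewrite ↥δ≡num = geq3pow-true (gallai n s) (↧ₙ δ) num (eG n s) (freeEdges n s) (edgesInTriangles n s)
    (3^freeEdges≤gallai n s) (freeEdges+edgesInTriangles n s) den*m≤num*e

eG≡countTrue : ∀ n s → length s ≡ numPairs n → eG n s ≡ countTrue s
eG≡countTrue n s ∣s∣≡N = length-selectEdges (pairsOf n) s (sym ∣s∣≡N)

probBad≡𝔼 : ∀ δ n q → probBad δ n q ≡ 𝔼 (numPairs n) q (λ s → 𝟙 (not (goodEvent δ n s)))
probBad≡𝔼 δ n q = ∑-cong-∈ (allBools (numPairs n)) (λ {s} s∈ → term s (length-∈-allBools (numPairs n) s∈))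
  where
  open ≡-Reasoning
  term : ∀ s → length s ≡ numPairs n →
         (if goodEvent δ n s then 0ℚ else q ^ℚ eG n s * (1ℚ - q) ^ℚ (numPairs n ∸ eG n s))
         ≡ weight q s * 𝟙 (not (goodEvent δ n s))
  term s ∣s∣≡N with goodEvent δ n s
  ... | true  = sym (*-zeroʳ (weight q s))
  ... | false = begin
    q ^ℚ eG n s * (1ℚ - q) ^ℚ (numPairs n ∸ eG n s)
      ≡⟨ cong₂ (λ e N → q ^ℚ e * (1ℚ - q) ^ℚ (N ∸ e)) (eG≡countTrue n s ∣s∣≡N) (sym ∣s∣≡N) ⟩
    q ^ℚ countTrue s * (1ℚ - q) ^ℚ (length s ∸ countTrue s)
      ≡⟨ sym (weight≡ q s) ⟩
    weight q s
      ≡⟨ sym (*-identityʳ (weight q s)) ⟩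
    weight q s * 1ℚ ∎

bad⇒triangles≥ : ∀ δ n s num → ↥ δ ≡ ℤ.+ num → goodEvent δ n s ≡ false → 1ℚ ≤ ℕtoℚ 3 * triangles n s
bad⇒triangles≥ δ n s num ↥δ≡num bad = ≤-trans (ℕtoℚ-mono-≤ 1≤m) (edgesInTriangles≤ n s)
  where
  1≤m : 1 ℕ.≤ edgesInTriangles n s
  1≤m with edgesInTriangles n s | bad⇒num*e<den*m δ n s num ↥δ≡num bad
  ... | zero  | lt rewrite ℕₚ.*-zeroʳ (↧ₙ δ) = ⊥-elim (ℕₚ.n≮0 lt)
  ... | suc _ | _  = s≤s z≤n

bad⇒edges≤triangles : ∀ δ n s num → ↥ δ ≡ ℤ.+ num → length s ≡ numPairs n → goodEvent δ n s ≡ false →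
                      ℕtoℚ num * ℕtoℚ (countTrue s) ≤ ℕtoℚ (↧ₙ δ) * (ℕtoℚ 3 * triangles n s)
bad⇒edges≤triangles δ n s num ↥δ≡num ∣s∣≡N bad = begin
  ℕtoℚ num * ℕtoℚ (countTrue s)           ≡⟨ sym (ℕtoℚ-* num (countTrue s)) ⟩
  ℕtoℚ (num ℕ.* countTrue s)              ≡⟨ cong (λ e → ℕtoℚ (num ℕ.* e)) (sym (eG≡countTrue n s ∣s∣≡N)) ⟩
  ℕtoℚ (num ℕ.* eG n s)                   ≤⟨ ℕtoℚ-mono-≤ (ℕₚ.<⇒≤ (bad⇒num*e<den*m δ n s num ↥δ≡num bad)) ⟩
  ℕtoℚ (↧ₙ δ ℕ.* edgesInTriangles n s)    ≡⟨ ℕtoℚ-* (↧ₙ δ) (edgesInTriangles n s) ⟩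
  ℕtoℚ (↧ₙ δ) * ℕtoℚ (edgesInTriangles n s) ≤⟨ *-monoˡ-≤-nonNeg′ (ℕtoℚ-nonNeg (↧ₙ δ)) (edgesInTriangles≤ n s) ⟩
  ℕtoℚ (↧ₙ δ) * (ℕtoℚ 3 * triangles n s)  ∎
  where open ≤-Reasoning

probBad-first-moment : ∀ δ n num → ↥ δ ≡ ℤ.+ num → 0ℚ ≤ q → q ≤ 1ℚ → probBad δ n q ≤ ℕtoℚ 3 * (ℕtoℚ n * q) ³
probBad-first-moment {q} δ n num ↥δ≡num 0≤q q≤1 = begin
  probBad δ n q                                        ≡⟨ probBad≡𝔼 δ n q ⟩
  𝔼 (numPairs n) q (λ s → 𝟙 (not (goodEvent δ n s)))   ≤⟨ 𝔼-mono-≤ (numPairs n) 0≤q q≤1 (λ s _ → 𝟙bad≤ s) ⟩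
  𝔼 (numPairs n) q (λ s → ℕtoℚ 3 * triangles n s)      ≡⟨ 𝔼-*ˡ (numPairs n) q (ℕtoℚ 3) (triangles n) ⟩
  ℕtoℚ 3 * 𝔼 (numPairs n) q (triangles n)              ≤⟨ *-monoˡ-≤-nonNeg′ (ℕtoℚ-nonNeg 3) (𝔼-triangles≤ n 0≤q q≤1) ⟩
  ℕtoℚ 3 * (ℕtoℚ n * q) ³                              ∎
  where
  open ≤-Reasoning
  𝟙bad≤ : ∀ s → 𝟙 (not (goodEvent δ n s)) ≤ ℕtoℚ 3 * triangles n s
  𝟙bad≤ s with goodEvent δ n s in good
  ... | true  = *-nonNeg (ℕtoℚ-nonNeg 3) (triangles-nonNeg n s)
  ... | false = bad⇒triangles≥ δ n s num ↥δ≡num good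

-- Second moment

-- Split on 2e ≤ μ: either e lies far below its mean μ, or a·e ≤ 3d·T pushes T far above its mean m.
deviation : ∀ {a d e μ T m} → 0ℚ ≤ a → 0ℚ ≤ μ → ℕtoℚ 12 * d * m ≤ a * μ → a * e ≤ d * (ℕtoℚ 3 * T) →
            (a * μ) ² ≤ (ℕtoℚ 2 * a) ² * (e - μ) ² + (ℕtoℚ 12 * d) ² * (T - m) ²
deviation {a} {d} {e} {μ} {T} {m} 0≤a 0≤μ 12dm≤aμ ae≤3dT with ≤-total (ℕtoℚ 2 * e) μ
... | inj₁ 2e≤μ = begin
  (a * μ) ²                                      ≤⟨ ²-mono-≤ (*-nonNeg 0≤a 0≤μ) (0≤y-x⇒x≤y {y = ℕtoℚ 2 * a * (μ - e)}
                                                      (≤-trans (*-nonNeg 0≤a (x≤y⇒0≤y-x 2e≤μ)) (≤-reflexive (few a e μ)))) ⟩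
  (ℕtoℚ 2 * a * (μ - e)) ²                       ≡⟨ flip a e μ ⟩
  (ℕtoℚ 2 * a) ² * (e - μ) ²                     ≤⟨ x≤x+y {x = (ℕtoℚ 2 * a) ² * (e - μ) ²}
                                                      (*-nonNeg (²-nonNeg (ℕtoℚ 12 * d)) (²-nonNeg (T - m))) ⟩
  (ℕtoℚ 2 * a) ² * (e - μ) ² + (ℕtoℚ 12 * d) ² * (T - m) ² ∎
  where
  open ≤-Reasoning
  few : ∀ a e μ → a * (μ - ℕtoℚ 2 * e) ≡ ℕtoℚ 2 * a * (μ - e) - a * μ
  few = solve 3 (λ a e μ →
    a :* (μ :- con (ℕtoℚ 2) :* e)
    := con (ℕtoℚ 2) :* a :* (μ :- e) :- a :* μ) refl
  flip : ∀ a e μ → (ℕtoℚ 2 * a * (μ - e)) * (ℕtoℚ 2 * a * (μ - e)) ≡ (ℕtoℚ 2 * a) * (ℕtoℚ 2 * a) * ((e - μ) * (e - μ))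
  flip = solve 3 (λ a e μ →
    (con (ℕtoℚ 2) :* a :* (μ :- e)) :* (con (ℕtoℚ 2) :* a :* (μ :- e))
    := (con (ℕtoℚ 2) :* a) :* (con (ℕtoℚ 2) :* a) :* ((e :- μ) :* (e :- μ))) refl
... | inj₂ μ≤2e = begin
  (a * μ) ²                                      ≤⟨ ²-mono-≤ (*-nonNeg 0≤a 0≤μ) (0≤y-x⇒x≤y {y = ℕtoℚ 12 * d * (T - m)}
                                                      (≤-trans slack (≤-reflexive (many a d e μ T m)))) ⟩
  (ℕtoℚ 12 * d * (T - m)) ²                      ≡⟨ split d T m ⟩
  (ℕtoℚ 12 * d) ² * (T - m) ²                    ≤⟨ y≤x+y {y = (ℕtoℚ 12 * d) ² * (T - m) ²}
                                                      (*-nonNeg (²-nonNeg (ℕtoℚ 2 * a)) (²-nonNeg (e - μ))) ⟩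
  (ℕtoℚ 2 * a) ² * (e - μ) ² + (ℕtoℚ 12 * d) ² * (T - m) ² ∎
  where
  open ≤-Reasoning
  slack : 0ℚ ≤ ℕtoℚ 4 * (d * (ℕtoℚ 3 * T) - a * e) + (ℕtoℚ 2 * a * (ℕtoℚ 2 * e - μ) + (a * μ - ℕtoℚ 12 * d * m))
  slack = +-nonNeg (*-nonNeg (ℕtoℚ-nonNeg 4) (x≤y⇒0≤y-x ae≤3dT))
                   (+-nonNeg (*-nonNeg (*-nonNeg (ℕtoℚ-nonNeg 2) 0≤a) (x≤y⇒0≤y-x μ≤2e)) (x≤y⇒0≤y-x 12dm≤aμ))
  many : ∀ a d e μ T m → ℕtoℚ 4 * (d * (ℕtoℚ 3 * T) - a * e) + (ℕtoℚ 2 * a * (ℕtoℚ 2 * e - μ) + (a * μ - ℕtoℚ 12 * d * m))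
                         ≡ ℕtoℚ 12 * d * (T - m) - a * μ
  many = solve 6 (λ a d e μ T m →
    con (ℕtoℚ 4) :* (d :* (con (ℕtoℚ 3) :* T) :- a :* e)
      :+ (con (ℕtoℚ 2) :* a :* (con (ℕtoℚ 2) :* e :- μ) :+ (a :* μ :- con (ℕtoℚ 12) :* d :* m))
    := con (ℕtoℚ 12) :* d :* (T :- m) :- a :* μ) refl
  split : ∀ d T m → (ℕtoℚ 12 * d * (T - m)) * (ℕtoℚ 12 * d * (T - m)) ≡ (ℕtoℚ 12 * d) * (ℕtoℚ 12 * d) * ((T - m) * (T - m))
  split = solve 3 (λ d T m →
    (con (ℕtoℚ 12) :* d :* (T :- m)) :* (con (ℕtoℚ 12) :* d :* (T :- m))
    := (con (ℕtoℚ 12) :* d) :* (con (ℕtoℚ 12) :* d) :* ((T :- m) :* (T :- m))) refl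

-- 48 = 12 · 4: the factor 12 of deviation and the 4 of n² ≤ 4·(n choose 2).
12d𝔼T≤aμ : ∀ n {a d} → 2 ℕ.≤ n → 1ℚ ≤ a → 0ℚ ≤ d → 0ℚ ≤ q → q ≤ 1ℚ →
           ℕtoℚ 48 * d * (ℕtoℚ n * q ²) ≤ 1ℚ →
           ℕtoℚ 12 * d * 𝔼 (numPairs n) q (triangles n) ≤ a * (ℕtoℚ (numPairs n) * q)
12d𝔼T≤aμ {q} n {a} {d} 2≤n 1≤a 0≤d 0≤q q≤1 small = *-cancelˡ-≤-pos′ (ℕtoℚ-pos 3) (begin
  ℕtoℚ 4 * (ℕtoℚ 12 * d * 𝔼 (numPairs n) q (triangles n))
    ≤⟨ *-monoˡ-≤-nonNeg′ (ℕtoℚ-nonNeg 4) (*-monoˡ-≤-nonNeg′ (*-nonNeg (ℕtoℚ-nonNeg 12) 0≤d) (𝔼-triangles≤ n 0≤q q≤1)) ⟩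
  ℕtoℚ 4 * (ℕtoℚ 12 * d * (nℚ * q) ³)
    ≡⟨ regroup nℚ q d ⟩
  nℚ ² * q * (ℕtoℚ 48 * d * (nℚ * q ²))
    ≤⟨ *-monoˡ-≤-nonNeg′ (*-nonNeg (²-nonNeg nℚ) 0≤q) small ⟩
  nℚ ² * q * 1ℚ
    ≡⟨ *-identityʳ _ ⟩
  nℚ ² * q
    ≤⟨ *-monoʳ-≤-nonNeg′ 0≤q (n²≤4*numPairs n 2≤n) ⟩
  ℕtoℚ 4 * Nℚ * q
    ≡⟨ *-assoc (ℕtoℚ 4) Nℚ q ⟩
  ℕtoℚ 4 * (Nℚ * q)
    ≤⟨ *-monoˡ-≤-nonNeg′ (ℕtoℚ-nonNeg 4) (≤-trans (≤-reflexive (sym (*-identityˡ (Nℚ * q))))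
                                              (*-monoʳ-≤-nonNeg′ (*-nonNeg (ℕtoℚ-nonNeg (numPairs n)) 0≤q) 1≤a)) ⟩
  ℕtoℚ 4 * (a * (Nℚ * q)) ∎)
  where
  open ≤-Reasoning
  nℚ = ℕtoℚ n
  Nℚ = ℕtoℚ (numPairs n)
  regroup : ∀ x q d → ℕtoℚ 4 * (ℕtoℚ 12 * d * ((x * q) * ((x * q) * (x * q))))
                      ≡ (x * x) * q * (ℕtoℚ 48 * d * (x * (q * q)))
  regroup = solve 3 (λ x q d →
    con (ℕtoℚ 4) :* (con (ℕtoℚ 12) :* d :* ((x :* q) :* ((x :* q) :* (x :* q))))
    := (x :* x) :* q :* (con (ℕtoℚ 48) :* d :* (x :* (q :* q)))) refl

bad⇒deviation : ∀ δ n num → ↥ δ ≡ ℤ.+ num → 1 ℕ.≤ num → 2 ℕ.≤ n → 0ℚ ≤ q → q ≤ 1ℚ →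
  ℕtoℚ 48 * ℕtoℚ (↧ₙ δ) * (ℕtoℚ n * q ²) ≤ 1ℚ → ∀ s → length s ≡ numPairs n →
  (ℕtoℚ num * (ℕtoℚ (numPairs n) * q)) ² * 𝟙 (not (goodEvent δ n s))
    ≤ (ℕtoℚ 2 * ℕtoℚ num) ² * (ℕtoℚ (countTrue s) - ℕtoℚ (numPairs n) * q) ²
      + (ℕtoℚ 12 * ℕtoℚ (↧ₙ δ)) ² * (triangles n s - 𝔼 (numPairs n) q (triangles n)) ²
bad⇒deviation {q} δ n num ↥δ≡num 1≤num 2≤n 0≤q q≤1 small s ∣s∣≡N = byCase (goodEvent δ n s) refl
  where
  α = ℕtoℚ num
  β = ℕtoℚ (↧ₙ δ)
  μ = ℕtoℚ (numPairs n) * q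
  eₛ = ℕtoℚ (countTrue s)
  Tₛ = triangles n s
  𝔼T = 𝔼 (numPairs n) q (triangles n)
  byCase : ∀ b → goodEvent δ n s ≡ b → (α * μ) ² * 𝟙 (not b) ≤ (ℕtoℚ 2 * α) ² * (eₛ - μ) ² + (ℕtoℚ 12 * β) ² * (Tₛ - 𝔼T) ²
  byCase true  _   = ≤-trans (≤-reflexive (*-zeroʳ ((α * μ) ²)))
    (+-nonNeg (*-nonNeg (²-nonNeg (ℕtoℚ 2 * α)) (²-nonNeg (eₛ - μ))) (*-nonNeg (²-nonNeg (ℕtoℚ 12 * β)) (²-nonNeg (Tₛ - 𝔼T))))
  byCase false bad = ≤-trans (≤-reflexive (*-identityʳ ((α * μ) ²)))
    (deviation {α} {β} {eₛ} {μ} {Tₛ} {𝔼T} (<⇒≤ (<-≤-trans (positive⁻¹ 1ℚ) 1≤α)) (*-nonNeg (ℕtoℚ-nonNeg (numPairs n)) 0≤q)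
               (12d𝔼T≤aμ n 2≤n 1≤α (ℕtoℚ-nonNeg (↧ₙ δ)) 0≤q q≤1 small)
               (bad⇒edges≤triangles δ n s num ↥δ≡num ∣s∣≡N bad))
    where
    1≤α : 1ℚ ≤ α
    1≤α = ℕtoℚ-mono-≤ 1≤num

probBad-second-moment : ∀ δ n num → ↥ δ ≡ ℤ.+ num → 1 ℕ.≤ num → 2 ℕ.≤ n → 0ℚ ≤ q → q ≤ 1ℚ →
  ℕtoℚ 48 * ℕtoℚ (↧ₙ δ) * (ℕtoℚ n * q ²) ≤ 1ℚ →
  (ℕtoℚ (numPairs n) * q) ² * probBad δ n q
    ≤ ℕtoℚ 4 * (ℕtoℚ (numPairs n) * q) + ℕtoℚ 9 * (ℕtoℚ 12 * ℕtoℚ (↧ₙ δ)) ² * (ℕtoℚ n ² * ℕtoℚ n ²) * q ³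
probBad-second-moment {q} δ n num ↥δ≡num 1≤num 2≤n 0≤q q≤1 small = *-cancelˡ-≤-pos′ (*-pos 0<α 0<α) (begin
  α ² * (μ ² * probBad δ n q)
    ≡⟨ reorder α μ (probBad δ n q) ⟩
  (α * μ) ² * probBad δ n q
    ≡⟨ cong ((α * μ) ² *_) (probBad≡𝔼 δ n q) ⟩
  (α * μ) ² * 𝔼 N q (λ s → 𝟙 (not (goodEvent δ n s)))
    ≡⟨ sym (𝔼-*ˡ N q ((α * μ) ²) (λ s → 𝟙 (not (goodEvent δ n s)))) ⟩
  𝔼 N q (λ s → (α * μ) ² * 𝟙 (not (goodEvent δ n s)))
    ≤⟨ 𝔼-mono-≤ N 0≤q q≤1 (bad⇒deviation δ n num ↥δ≡num 1≤num 2≤n 0≤q q≤1 small) ⟩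
  𝔼 N q (λ s → Cₑ * (edgeCount s - μ) ² + Cₜ * (triangles n s - 𝔼T) ²)
    ≡⟨ trans (𝔼-+ N q (λ s → Cₑ * (edgeCount s - μ) ²) (λ s → Cₜ * (triangles n s - 𝔼T) ²))
             (cong₂ _+_ (𝔼-*ˡ N q Cₑ (λ s → (edgeCount s - μ) ²)) (𝔼-*ˡ N q Cₜ (λ s → (triangles n s - 𝔼T) ²))) ⟩
  Cₑ * 𝔼 N q (λ s → (edgeCount s - μ) ²) + Cₜ * 𝔼 N q (λ s → (triangles n s - 𝔼T) ²)
    ≤⟨ +-mono-≤ (*-monoˡ-≤-nonNeg′ (²-nonNeg (ℕtoℚ 2 * α)) edgeVariance≤)
                (*-monoˡ-≤-nonNeg′ (²-nonNeg (ℕtoℚ 12 * β)) (𝔼-triangles-variance≤ n 0≤q q≤1)) ⟩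
  Cₑ * μ + varT
    ≤⟨ +-monoʳ-≤ (Cₑ * μ) (≤-trans (≤-reflexive (sym (*-identityˡ varT)))
                                    (*-monoʳ-≤-nonNeg′ 0≤varT (²-mono-≤ 0≤1 1≤α))) ⟩
  Cₑ * μ + α ² * varT
    ≡⟨ factor α μ β (nℚ ² * nℚ ²) (q ³) ⟩
  α ² * (ℕtoℚ 4 * μ + ℕtoℚ 9 * (ℕtoℚ 12 * β) ² * (nℚ ² * nℚ ²) * q ³) ∎)
  where
  open ≤-Reasoning
  N = numPairs n
  nℚ = ℕtoℚ n
  α = ℕtoℚ num
  β = ℕtoℚ (↧ₙ δ)
  μ = ℕtoℚ N * q
  𝔼T = 𝔼 N q (triangles n)
  Cₑ = (ℕtoℚ 2 * α) ²
  Cₜ = (ℕtoℚ 12 * β) ²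
  varT = Cₜ * (ℕtoℚ 9 * (nℚ ² * nℚ ²) * q ³)
  0≤varT : 0ℚ ≤ varT
  0≤varT = *-nonNeg (²-nonNeg (ℕtoℚ 12 * β))
             (*-nonNeg (*-nonNeg (ℕtoℚ-nonNeg 9) (*-nonNeg (²-nonNeg nℚ) (²-nonNeg nℚ))) (³-nonNeg 0≤q))
  edgeCount : List Bool → ℚ
  edgeCount s = ℕtoℚ (countTrue s)
  1≤α : 1ℚ ≤ α
  1≤α = ℕtoℚ-mono-≤ 1≤num
  0<α : 0ℚ < α
  0<α = <-≤-trans (positive⁻¹ 1ℚ) 1≤α
  0≤μ : 0ℚ ≤ μ
  0≤μ = *-nonNeg (ℕtoℚ-nonNeg N) 0≤q
  edgeVariance≤ : 𝔼 N q (λ s → (edgeCount s - μ) ²) ≤ μ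
  edgeVariance≤ = begin
    𝔼 N q (λ s → (edgeCount s - μ) ²) ≡⟨ 𝔼-countTrue-variance N q ⟩
    μ * (1ℚ - q)                      ≤⟨ *-monoˡ-≤-nonNeg′ 0≤μ (x-y≤x 0≤q) ⟩
    μ * 1ℚ                            ≡⟨ *-identityʳ μ ⟩
    μ                                 ∎
  reorder : ∀ a μ P → (a * a) * ((μ * μ) * P) ≡ ((a * μ) * (a * μ)) * P
  reorder = solve 3 (λ a μ P → (a :* a) :* ((μ :* μ) :* P) := ((a :* μ) :* (a :* μ)) :* P) refl
  factor : ∀ a μ d y z → (ℕtoℚ 2 * a) * (ℕtoℚ 2 * a) * μ + (a * a) * ((ℕtoℚ 12 * d) * (ℕtoℚ 12 * d) * (ℕtoℚ 9 * y * z))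
                         ≡ (a * a) * (ℕtoℚ 4 * μ + ℕtoℚ 9 * ((ℕtoℚ 12 * d) * (ℕtoℚ 12 * d)) * y * z)
  factor = solve 5 (λ a μ d y z →
    (con (ℕtoℚ 2) :* a) :* (con (ℕtoℚ 2) :* a) :* μ
      :+ (a :* a) :* ((con (ℕtoℚ 12) :* d) :* (con (ℕtoℚ 12) :* d) :* (con (ℕtoℚ 9) :* y :* z))
    := (a :* a) :* (con (ℕtoℚ 4) :* μ :+ con (ℕtoℚ 9) :* ((con (ℕtoℚ 12) :* d) :* (con (ℕtoℚ 12) :* d)) :* y :* z)) refl

-- Unless the first moment bound already gives P ≤ ε, x·q is bounded below, hence 8 ≤ ε·μ for
-- μ = N·q, and then the second moment bound gives P ≤ ε.
moments⇒≤ε : ∀ {x q P N ε C} → 1ℚ ≤ x → 0ℚ ≤ q → 0ℚ ≤ N → 0ℚ ≤ C → 0ℚ < ε →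
            x ² ≤ ℕtoℚ 4 * N → x * q ² ≤ 1ℚ →
            P ≤ ℕtoℚ 3 * (x * q) ³ →
            (N * q) ² * P ≤ ℕtoℚ 4 * (N * q) + C * (x ² * x ²) * q ³ →
            (ℕtoℚ 32 * C) ² ≤ x * ε ² →
            ℕtoℚ 3 * ℕtoℚ 4 ³ * ℕtoℚ 8 ³ ≤ x * ε ² ² →
            P ≤ ε
moments⇒≤ε {x} {q} {P} {N} {ε} {C} 1≤x 0≤q 0≤N 0≤C 0<ε x²≤4N xq²≤1 firstMoment secondMoment bigX₁ bigX₂ =
  [ ≤-trans firstMoment , viaSecondMoment ]′ (≤-total (ℕtoℚ 3 * (x * q) ³) ε)
  where
  μ = N * q
  0≤x = ≤-trans 0≤1 1≤x
  0≤ε = <⇒≤ 0<ε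
  0≤μ : 0ℚ ≤ μ
  0≤μ = *-nonNeg 0≤N 0≤q
  viaSecondMoment : ε ≤ ℕtoℚ 3 * (x * q) ³ → P ≤ ε
  viaSecondMoment large = *-cancelˡ-≤-pos′ (*-pos 0<μ 0<μ) (*-cancelˡ-≤-pos′ (ℕtoℚ-pos 1) (begin
    ℕtoℚ 2 * (μ ² * P)                                         ≤⟨ *-monoˡ-≤-nonNeg′ (ℕtoℚ-nonNeg 2) secondMoment ⟩
    ℕtoℚ 2 * (ℕtoℚ 4 * μ + C * (x ² * x ²) * q ³)              ≡⟨ *-distribˡ-+ (ℕtoℚ 2) (ℕtoℚ 4 * μ) _ ⟩
    ℕtoℚ 2 * (ℕtoℚ 4 * μ) + ℕtoℚ 2 * (C * (x ² * x ²) * q ³)   ≤⟨ +-mono-≤ edgeTerm triangleTerm ⟩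
    ε * μ ² + ε * μ ²                                          ≡⟨ double (ε * μ ²) ⟩
    ℕtoℚ 2 * (ε * μ ²)                                         ≡⟨ cong (ℕtoℚ 2 *_) (*-comm ε (μ ²)) ⟩
    ℕtoℚ 2 * (μ ² * ε)                                         ∎))
    where
    open ≤-Reasoning
    double : ∀ z → z + z ≡ ℕtoℚ 2 * z
    double = solve 1 (λ z → z :+ z := con (ℕtoℚ 2) :* z) refl
    x≤x³ : x ≤ x ³
    x≤x³ = begin
      x          ≡⟨ sym (*-identityʳ x) ⟩
      x * 1ℚ     ≤⟨ *-monoˡ-≤-nonNeg′ 0≤x (*-mono-≤-nonNeg′ 0≤1 0≤1 1≤x 1≤x) ⟩
      x ³        ∎
    0<3·4³ : 0ℚ < ℕtoℚ 3 * ℕtoℚ 4 ³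
    0<3·4³ = *-pos (ℕtoℚ-pos 2) (*-pos (ℕtoℚ-pos 3) (*-pos (ℕtoℚ-pos 3) (ℕtoℚ-pos 3)))
    8≤εμ : ℕtoℚ 8 ≤ ε * μ
    8≤εμ = ³-cancel-≤ (*-nonNeg 0≤ε 0≤μ) (*-cancelˡ-≤-pos′ 0<3·4³ (begin
      ℕtoℚ 3 * ℕtoℚ 4 ³ * ℕtoℚ 8 ³   ≤⟨ bigX₂ ⟩
      x * ε ² ²                      ≤⟨ *-monoʳ-≤-nonNeg′ (²-nonNeg (ε ²)) x≤x³ ⟩
      x ³ * ε ² ²                    ≡⟨ regroup₁ x ε ⟩
      ε ³ * x ³ * ε                  ≤⟨ *-monoˡ-≤-nonNeg′ (*-nonNeg (³-nonNeg 0≤ε) (³-nonNeg 0≤x)) large ⟩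
      ε ³ * x ³ * (ℕtoℚ 3 * (x * q) ³) ≡⟨ regroup₂ x q ε ⟩
      ℕtoℚ 3 * (ε ³ * q ³) * (x ²) ³ ≤⟨ *-monoˡ-≤-nonNeg′ (*-nonNeg (ℕtoℚ-nonNeg 3) (*-nonNeg (³-nonNeg 0≤ε) (³-nonNeg 0≤q)))
                                          (³-mono-≤ (²-nonNeg x) x²≤4N) ⟩
      ℕtoℚ 3 * (ε ³ * q ³) * (ℕtoℚ 4 * N) ³ ≡⟨ regroup₃ N q ε ⟩
      ℕtoℚ 3 * ℕtoℚ 4 ³ * (ε * μ) ³  ∎))
      where
      regroup₁ : ∀ x ε → x * (x * x) * ((ε * ε) * (ε * ε)) ≡ ε * (ε * ε) * (x * (x * x)) * ε
      regroup₁ = solve 2 (λ x ε →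
        x :* (x :* x) :* ((ε :* ε) :* (ε :* ε))
        := ε :* (ε :* ε) :* (x :* (x :* x)) :* ε) refl
      regroup₂ : ∀ x q ε → ε * (ε * ε) * (x * (x * x)) * (ℕtoℚ 3 * ((x * q) * ((x * q) * (x * q))))
                           ≡ ℕtoℚ 3 * (ε * (ε * ε) * (q * (q * q))) * ((x * x) * ((x * x) * (x * x)))
      regroup₂ = solve 3 (λ x q ε →
        ε :* (ε :* ε) :* (x :* (x :* x)) :* (con (ℕtoℚ 3) :* ((x :* q) :* ((x :* q) :* (x :* q))))
        := con (ℕtoℚ 3) :* (ε :* (ε :* ε) :* (q :* (q :* q))) :* ((x :* x) :* ((x :* x) :* (x :* x)))) refl
      regroup₃ : ∀ N q ε → ℕtoℚ 3 * (ε * (ε * ε) * (q * (q * q))) * ((ℕtoℚ 4 * N) * ((ℕtoℚ 4 * N) * (ℕtoℚ 4 * N)))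
                           ≡ ℕtoℚ 3 * (ℕtoℚ 4 * (ℕtoℚ 4 * ℕtoℚ 4)) * ((ε * (N * q)) * ((ε * (N * q)) * (ε * (N * q))))
      regroup₃ = solve 3 (λ N q ε →
        con (ℕtoℚ 3) :* (ε :* (ε :* ε) :* (q :* (q :* q)))
          :* ((con (ℕtoℚ 4) :* N) :* ((con (ℕtoℚ 4) :* N) :* (con (ℕtoℚ 4) :* N)))
        := con (ℕtoℚ 3) :* (con (ℕtoℚ 4) :* (con (ℕtoℚ 4) :* con (ℕtoℚ 4)))
          :* ((ε :* (N :* q)) :* ((ε :* (N :* q)) :* (ε :* (N :* q))))) refl
    0<μ : 0ℚ < μ
    0<μ = *-cancelˡ-<-nonNeg ε {{nonNegative 0≤ε}} (≤-<-trans (≤-reflexive (*-zeroʳ ε)) (<-≤-trans (ℕtoℚ-pos 7) 8≤εμ))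
    32Cq≤ε : ℕtoℚ 32 * C * q ≤ ε
    32Cq≤ε = ²-cancel-≤ 0≤ε (*-cancelˡ-≤-pos′ (<-≤-trans (positive⁻¹ 1ℚ) 1≤x) (begin
      x * (ℕtoℚ 32 * C * q) ²        ≡⟨ regroup (ℕtoℚ 32 * C) x q ⟩
      (ℕtoℚ 32 * C) ² * (x * q ²)    ≤⟨ *-monoˡ-≤-nonNeg′ (²-nonNeg (ℕtoℚ 32 * C)) xq²≤1 ⟩
      (ℕtoℚ 32 * C) ² * 1ℚ           ≡⟨ *-identityʳ _ ⟩
      (ℕtoℚ 32 * C) ²                ≤⟨ bigX₁ ⟩
      x * ε ²                        ∎))
      where
      regroup : ∀ k x q → x * ((k * q) * (k * q)) ≡ (k * k) * (x * (q * q))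
      regroup = solve 3 (λ k x q → x :* ((k :* q) :* (k :* q)) := (k :* k) :* (x :* (q :* q))) refl
    edgeTerm : ℕtoℚ 2 * (ℕtoℚ 4 * μ) ≤ ε * μ ²
    edgeTerm = begin
      ℕtoℚ 2 * (ℕtoℚ 4 * μ)   ≡⟨ regroup μ ⟩
      ℕtoℚ 8 * μ              ≤⟨ *-monoʳ-≤-nonNeg′ 0≤μ 8≤εμ ⟩
      ε * μ * μ               ≡⟨ *-assoc ε μ μ ⟩
      ε * μ ²                 ∎
      where
      regroup : ∀ μ → ℕtoℚ 2 * (ℕtoℚ 4 * μ) ≡ ℕtoℚ 8 * μ
      regroup = solve 1 (λ μ → con (ℕtoℚ 2) :* (con (ℕtoℚ 4) :* μ) := con (ℕtoℚ 8) :* μ) refl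
    triangleTerm : ℕtoℚ 2 * (C * (x ² * x ²) * q ³) ≤ ε * μ ²
    triangleTerm = begin
      ℕtoℚ 2 * (C * (x ² * x ²) * q ³)                 ≤⟨ *-monoˡ-≤-nonNeg′ (ℕtoℚ-nonNeg 2) (*-monoʳ-≤-nonNeg′ (³-nonNeg 0≤q)
                                                            (*-monoˡ-≤-nonNeg′ 0≤C (*-mono-≤-nonNeg′ (²-nonNeg x) (²-nonNeg x) x²≤4N x²≤4N))) ⟩
      ℕtoℚ 2 * (C * ((ℕtoℚ 4 * N) * (ℕtoℚ 4 * N)) * q ³) ≡⟨ regroup C N q ⟩
      ℕtoℚ 32 * C * q * μ ²                            ≤⟨ *-monoʳ-≤-nonNeg′ (²-nonNeg μ) 32Cq≤ε ⟩
      ε * μ ²                                          ∎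
      where
      regroup : ∀ C N q → ℕtoℚ 2 * (C * ((ℕtoℚ 4 * N) * (ℕtoℚ 4 * N)) * (q * (q * q)))
                          ≡ ℕtoℚ 32 * C * q * ((N * q) * (N * q))
      regroup = solve 3 (λ C N q →
        con (ℕtoℚ 2) :* (C :* ((con (ℕtoℚ 4) :* N) :* (con (ℕtoℚ 4) :* N)) :* (q :* (q :* q)))
        := con (ℕtoℚ 32) :* C :* q :* ((N :* q) :* (N :* q))) refl

probBad→0 : ∀ δ num (p : ℕ → ℚ) → ↥ δ ≡ ℤ.+ num → 1 ℕ.≤ num → (∀ n → 0ℚ ≤ p n × p n ≤ 1ℚ) →
            (∀ n → ℕtoℚ 48 * ℕtoℚ (↧ₙ δ) * (ℕtoℚ n * p n ²) ≤ 1ℚ) →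
            ∀ ε → 0ℚ < ε → ∃[ N ] ((n : ℕ) → n ≥ N → probBad δ n (p n) ≤ ε)
probBad→0 δ num p ↥δ≡num 1≤num p∈[0,1] small ε 0<ε = 2 ℕ.+ (N₁ ℕ.+ N₂) , eventually
  where
  C = ℕtoℚ 9 * (ℕtoℚ 12 * ℕtoℚ (↧ₙ δ)) ²
  0<ε² : 0ℚ < ε ²
  0<ε² = *-pos 0<ε 0<ε
  0<ε⁴ : 0ℚ < ε ² ²
  0<ε⁴ = *-pos 0<ε² 0<ε²
  bound₁ = archimedean-* 0<ε² ((ℕtoℚ 32 * C) ²)
  bound₂ = archimedean-* 0<ε⁴ (ℕtoℚ 3 * ℕtoℚ 4 ³ * ℕtoℚ 8 ³)
  N₁ = proj₁ bound₁
  N₂ = proj₁ bound₂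
  1≤48d : 1ℚ ≤ ℕtoℚ 48 * ℕtoℚ (↧ₙ δ)
  1≤48d = ≤-trans (ℕtoℚ-mono-≤ (ℕₚ.≤-trans (s≤s z≤n) (ℕₚ.m≤n*m (↧ₙ δ) 48))) (≤-reflexive (ℕtoℚ-* 48 (↧ₙ δ)))
  eventually : ∀ n → n ≥ 2 ℕ.+ (N₁ ℕ.+ N₂) → probBad δ n (p n) ≤ ε
  eventually n n≥N =
    moments⇒≤ε {ℕtoℚ n} {p n} {probBad δ n (p n)} {ℕtoℚ (numPairs n)} {ε} {C}
      (ℕtoℚ-mono-≤ (ℕₚ.≤-trans (s≤s z≤n) 2≤n)) 0≤q (ℕtoℚ-nonNeg (numPairs n))
      (*-nonNeg (ℕtoℚ-nonNeg 9) (²-nonNeg (ℕtoℚ 12 * ℕtoℚ (↧ₙ δ)))) 0<ε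
      (n²≤4*numPairs n 2≤n) nq²≤1
      (probBad-first-moment δ n num ↥δ≡num 0≤q q≤1)
      (probBad-second-moment δ n num ↥δ≡num 1≤num 2≤n 0≤q q≤1 (small n))
      (≤-trans (proj₂ bound₁) (*-monoʳ-≤-nonNeg′ (<⇒≤ 0<ε²) (ℕtoℚ-mono-≤ N₁≤n)))
      (≤-trans (proj₂ bound₂) (*-monoʳ-≤-nonNeg′ (<⇒≤ 0<ε⁴) (ℕtoℚ-mono-≤ N₂≤n)))
    where
    0≤q = proj₁ (p∈[0,1] n)
    q≤1 = proj₂ (p∈[0,1] n)
    2≤n : 2 ℕ.≤ n
    2≤n = ℕₚ.≤-trans (ℕₚ.m≤m+n 2 (N₁ ℕ.+ N₂)) n≥N
    N₁≤n : N₁ ℕ.≤ n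
    N₁≤n = ℕₚ.≤-trans (ℕₚ.m≤m+n N₁ N₂) (ℕₚ.≤-trans (ℕₚ.m≤n+m (N₁ ℕ.+ N₂) 2) n≥N)
    N₂≤n : N₂ ℕ.≤ n
    N₂≤n = ℕₚ.≤-trans (ℕₚ.m≤n+m N₂ N₁) (ℕₚ.≤-trans (ℕₚ.m≤n+m (N₁ ℕ.+ N₂) 2) n≥N)
    nq²≤1 : ℕtoℚ n * p n ² ≤ 1ℚ
    nq²≤1 = ≤-trans (≤-trans (≤-reflexive (sym (*-identityˡ (ℕtoℚ n * p n ²))))
                             (*-monoʳ-≤-nonNeg′ (*-nonNeg (ℕtoℚ-nonNeg n) (²-nonNeg (p n))) 1≤48d))
                    (small n)

density-bound : ∀ {K c x q} → c * K ≡ 1ℚ → q * q * x ≤ c * c → K ² * (x * q ²) ≤ 1ℚ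
density-bound {K} {c} {x} {q} cK≡1 q²x≤c² = begin
  K ² * (x * q ²)     ≡⟨ cong (K ² *_) (*-comm x (q ²)) ⟩
  K ² * (q * q * x)   ≤⟨ *-monoˡ-≤-nonNeg′ (²-nonNeg K) q²x≤c² ⟩
  K ² * (c * c)       ≡⟨ regroup K c ⟩
  (c * K) ²           ≡⟨ cong _² cK≡1 ⟩
  1ℚ                  ∎
  where
  open ≤-Reasoning
  regroup : ∀ K c → (K * K) * (c * c) ≡ (c * K) * (c * K)
  regroup = solve 2 (λ K c → (K :* K) :* (c :* c) := (c :* K) :* (c :* K)) refl

48d≤[7d]² : ∀ d → ℕtoℚ 48 * ℕtoℚ (suc d) ≤ ℕtoℚ (7 ℕ.* suc d) ²
48d≤[7d]² d = begin
  ℕtoℚ 48 * ℕtoℚ (suc d)                     ≡⟨ sym (ℕtoℚ-* 48 (suc d)) ⟩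
  ℕtoℚ (48 ℕ.* suc d)                        ≤⟨ ℕtoℚ-mono-≤ (ℕₚ.≤-trans (ℕₚ.*-monoˡ-≤ (suc d) (ℕₚ.n≤1+n 48))
                                                  (ℕₚ.≤-trans (ℕₚ.m≤m*n (49 ℕ.* suc d) (suc d)) (ℕₚ.≤-reflexive (square d)))) ⟩
  ℕtoℚ (7 ℕ.* suc d ℕ.* (7 ℕ.* suc d))       ≡⟨ ℕtoℚ-* (7 ℕ.* suc d) (7 ℕ.* suc d) ⟩
  ℕtoℚ (7 ℕ.* suc d) ²                       ∎
  where
  open ≤-Reasoning
  square : ∀ d → 49 ℕ.* suc d ℕ.* suc d ≡ 7 ℕ.* suc d ℕ.* (7 ℕ.* suc d)
  square = ℕSolver.solve-∀

numerator-suc : ∀ {δ} → 0ℚ < δ → ∃[ k ] ↥ δ ≡ ℤ.+ suc k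
numerator-suc {mkℚ (ℤ.+ suc k) _ _} _   = k , refl
numerator-suc {mkℚ (ℤ.+ 0) _ _}     0<δ = ⊥-elim (ℤ.Positive.pos (positive 0<δ))
numerator-suc {mkℚ -[1+ _ ] _ _}    0<δ = ⊥-elim (ℤ.Positive.pos (positive 0<δ))

lemma3p1 : (δ : ℚ) → 0ℚ < δ →
    ∃[ c ] (0ℚ < c ×
      ((p : ℕ → ℚ) → (∀ n → 0ℚ ≤ p n × p n ≤ 1ℚ) →
        (∀ n → (p n * p n) * ℕtoℚ n ≤ c * c) →
        (ε : ℚ) → 0ℚ < ε →
          ∃[ N ] ((n : ℕ) → n ≥ N → probBad δ n (p n) ≤ ε)))
lemma3p1 δ 0<δ = cδ , 0<cδ , λ p p∈[0,1] p²n≤c² →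
  probBad→0 δ (suc k) p ↥δ≡1+k (s≤s z≤n) p∈[0,1] (λ n →
    ≤-trans (*-monoʳ-≤-nonNeg′ (*-nonNeg (ℕtoℚ-nonNeg n) (²-nonNeg (p n))) (48d≤[7d]² (ℚ.ℚ.denominator-1 δ)))
            (density-bound {K} {cδ} {ℕtoℚ n} {p n} cK≡1 (p²n≤c² n)))
  where
  k = proj₁ (numerator-suc 0<δ)
  ↥δ≡1+k = proj₂ (numerator-suc 0<δ)
  -- c = 1/K with K = 7d for the denominator d of δ; since 48 d ≤ K², p² n ≤ c² gives 48 d n p² ≤ 1.
  K = ℕtoℚ (7 ℕ.* ↧ₙ δ)
  instance
    K-pos : Positive K
    K-pos = normalize-pos (7 ℕ.* ↧ₙ δ) 1
    K≢0 = pos⇒nonZero K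
  cδ = 1/ K
  0<cδ : 0ℚ < cδ
  0<cδ = positive⁻¹ cδ {{1/pos⇒pos K}}
  cK≡1 : cδ * K ≡ 1ℚ
  cK≡1 = *-inverseˡ K
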